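{- Let $q$ be a prime power and let $\sigma\ge 2$ be an integer. Let $C\subseteq\mathbb{F}_q^n$ be a linear $[n,k,n-k]_q$ code (length $n$, dimension $k$, minimum distance $n-k$) whose dual $C^\perp$ is an $[n,n-k,k-\sigma+2]_q$ code, and let $(A_0,\ldots,A_n)$ be the weight distribution of $C$. Then the values $A_{n-k},\ldots,A_{n-k+\sigma-2}$ determine the entire weight distribution of $C$; explicitly, for every $0\le i\le k-\sigma+1$, $$A_{n-k+\sigma-1+i}=\sum_{j=0}^{i}(-1)^{i-j}\binom{k-\sigma+1-j}{i-j}\left[\binom{n}{n-k+\sigma-1+j}\left(q^{j+\sigma-1}-1\right)-\sum_{h=0}^{\sigma-2}\binom{k-h}{\sigma-1+j-h}A_{n-k+h}\right],$$ while $A_0=1$ and $A_s=0$ for $1\le s\le n-k-1$.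
   Context: $A_i$ is the number of codewords of $C$ of Hamming weight $i$; $C^\perp=\{x\in\mathbb{F}_q^n : x\cdot c=0 \text{ for all } c\in C\}$ is the dual code. Such a code $C$ (Singleton defect $1$) is called almost-MDS; $\sigma$ is the sum of the Singleton defects of $C$ and $C^\perp$. Binomial coefficients $\binom{a}{b}$ with $b<0$ or $b>a$ are $0$. -}

module Defs where

open import Level using (0ℓ)
open import Data.Bool using (Bool; true; false; _∧_; if_then_else_)
open import Data.Nat as ℕ using (ℕ; zero; suc; _≤_; _∸_; _≡ᵇ_)
open import Data.Nat.Primality using (Prime)
open import Data.Nat.Combinatorics using (_C_)
open import Data.Integer as ℤ using (ℤ; +_)
open import Data.List using (List; []; _∷_; [_]; map; concatMap; length)
open import Data.Bool.ListAction using (any)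
open import Data.List.Membership.Propositional using (_∈_)
open import Data.List.Relation.Unary.Unique.Propositional using (Unique)
open import Data.Vec using (Vec; []; _∷_; replicate; zipWith)
import Data.Vec.Properties as VecP
open import Data.Product using (Σ; ∃; ∃-syntax; _×_; _,_)
open import Relation.Nullary using (¬_; does)
open import Relation.Binary.Definitions using (DecidableEquality)
open import Relation.Binary.PropositionalEquality using (_≡_; _≢_)
open import Algebra.Structures using (IsCommutativeRing)

IsPrimePower : ℕ → Set
IsPrimePower q = ∃[ p ] ∃[ e ] (Prime p × 1 ≤ e × q ≡ p ℕ.^ e)

record FiniteField (q : ℕ) : Set₁ where
  infixl 6 _+_
  infixl 7 _*_
  field
    F            : Set
    _≟_          : DecidableEquality F
    0# 1#        : F
    _+_ _*_      : F → F → F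
    -_           : F → F
    isCommRing   : IsCommutativeRing _≡_ _+_ _*_ -_ 0# 1#
    0≢1          : 0# ≢ 1#
    inverse      : ∀ x → x ≢ 0# → ∃[ y ] (x * y ≡ 1#)
    elements     : List F
    complete     : ∀ x → x ∈ elements
    unique       : Unique elements
    size         : length elements ≡ q

sumBelow : ℕ → (ℕ → ℤ) → ℤ
sumBelow zero    f = + 0
sumBelow (suc m) f = sumBelow m f ℤ.+ f m

countWhere : {A : Set} → (A → Bool) → List A → ℕ
countWhere p []       = 0
countWhere p (x ∷ xs) = if p x then suc (countWhere p xs) else countWhere p xs

module Code {q : ℕ} (𝔽 : FiniteField q) where
  open FiniteField 𝔽

  allVecs : (n : ℕ) → List (Vec F n)
  allVecs zero    = [ [] ]
  allVecs (suc n) = concatMap (λ a → map (a ∷_) (allVecs n)) elements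

  zeroVec : (n : ℕ) → Vec F n
  zeroVec n = replicate n 0#

  wt : {n : ℕ} → Vec F n → ℕ
  wt []      = 0
  wt (x ∷ v) = (if does (x ≟ 0#) then 0 else 1) ℕ.+ wt v

  dot : {n : ℕ} → Vec F n → Vec F n → F
  dot []      []      = 0#
  dot (x ∷ u) (y ∷ v) = x * y + dot u v

  -- encoding m ↦ m G for a k × n generator matrix G (rows g_1..g_k)
  encode : {n k : ℕ} → Vec (Vec F n) k → Vec F k → Vec F n
  encode {n} []      []      = zeroVec n
  encode     (g ∷ G) (a ∷ m) = zipWith _+_ (Data.Vec.map (a *_) g) (encode G m)

  -- G has rank k (the encoding map F^k → F^n is injective),
  -- so C = rowspace G is an [n,k] linear code
  FullRank : {n k : ℕ} → Vec (Vec F n) k → Set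
  FullRank G = ∀ m m' → encode G m ≡ encode G m' → m ≡ m'

  InCode : {n k : ℕ} → Vec (Vec F n) k → Vec F n → Set
  InCode G x = ∃[ m ] (encode G m ≡ x)

  InDual : {n k : ℕ} → Vec (Vec F n) k → Vec F n → Set
  InDual G x = ∀ c → InCode G c → dot x c ≡ 0#

  isCodeword : {n k : ℕ} → Vec (Vec F n) k → Vec F n → Bool
  isCodeword {n} {k} G x =
    any (λ m → does (VecP.≡-dec _≟_ (encode G m) x)) (allVecs k)

  MinDistance : {n : ℕ} → (Vec F n → Set) → ℕ → Set
  MinDistance {n} P d =
    (∀ x → P x → x ≢ zeroVec n → d ≤ wt x)
    × (∃[ x ] (P x × x ≢ zeroVec n × wt x ≡ d))

  A : {n k : ℕ} → Vec (Vec F n) k → ℕ → ℕ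
  A {n} G i = countWhere (λ x → isCodeword G x ∧ (wt x ≡ᵇ i)) (allVecs n)

-- The dual distance d⊥ = k − σ + 2 makes C an orthogonal array of strength k − σ + 1: on any set S
-- of at most k − σ + 1 coordinates every pattern is taken by exactly q^(k − |S|) codewords.  This goes
-- by induction on |S|: adding a coordinate j, either some codeword vanishing on S has c_j = 1, and its
-- multiples translate the codewords with a given c_j onto each other, or c_j is a linear combination of
-- the coordinates in S, which yields a dual word of weight at most |S| + 1 < d⊥.  Counting pairs (c, T)
-- with |T| = t and c vanishing on T in two ways gives the binomial moments
--   Σ_w C(n − w, t) A_w = C(n, t) q^(k − t)   for t ≤ k − σ + 1.
-- Since A_0 = 1 and A_w = 0 for 0 < w < n − k, moving A_(n−k), …, A_(n−k+σ−2) to the right-hand side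
-- leaves a triangular system in the A_(n−k+σ−1+i), which binomial inversion solves.

module Submission where

open import Level using (0ℓ)
open import Algebra.Bundles using (CommutativeRing; AbelianGroup)
open import Algebra.Structures using (IsAbelianGroup)
import Algebra.Properties.AbelianGroup as AbelianGroupProperties
import Algebra.Properties.CommutativeSemigroup as CommSemigroupProperties
import Algebra.Properties.Ring as RingProperties
open import Data.Bool using (Bool; true; false; T; _∧_; if_then_else_)
open import Data.Bool.Properties using (∧-identityʳ; ∧-comm; ∧-assoc; T-∧; T-≡)
open import Data.Empty using (⊥; ⊥-elim)
open import Data.Fin as Fin using (Fin; zero; suc)
open import Data.Fin.Subset as Subset using (Subset; inside; outside; ∣_∣; ⊤)
open import Data.Fin.Subset.Properties using (∣⊥∣≡0; ∣⊤∣≡n)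
open import Data.Integer as ℤ using (ℤ; +_; -[1+_])
import Data.Integer.Properties as ℤP
open import Data.Integer.Tactic.RingSolver using () renaming (solve-∀ to solve-∀ℤ)
open import Data.List as List using (List; []; _∷_; length; filterᵇ; concatMap)
import Data.List.Properties as List
open import Data.List.Membership.Propositional using (_∈_; lose)
open import Data.List.Membership.Propositional.Properties
  using (∈-filter⁺; ∈-filter⁻; ∈-map⁺; ∈-map⁻; ∈-++⁺ˡ; ∈-++⁺ʳ; ∈-++⁻)
open import Data.List.Membership.Propositional.Properties.WithK using (unique∧set⇒bag)
open import Data.List.Relation.Binary.BagAndSetEquality using (∼bag⇒↭)
open import Data.List.Relation.Binary.Permutation.Propositional as ↭ using (_↭_)
open import Data.List.Relation.Unary.All using ([]; _∷_)
open import Data.List.Relation.Unary.All.Properties using (All¬⇒¬Any)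
import Data.List.Relation.Unary.AllPairs as AllPairs
open import Data.List.Relation.Unary.Any as Any using (here; there; any?)
open import Data.List.Relation.Unary.Any.Properties using (any⁺; any⁻)
open import Data.List.Relation.Unary.Unique.Propositional using (Unique)
import Data.List.Relation.Unary.Unique.Propositional.Properties as Unique
open import Data.Nat as ℕ using (ℕ; zero; suc; _≤_; _<_; z≤n; s≤s; _^_; _∸_; _≡ᵇ_)
open import Data.Nat.Combinatorics
  using (_C_; nCk+nC[k+1]≡[n+1]C[k+1]; nCk≡n!/k![n-k]!; k![n∸k]!∣n!; nCk≡nC[n∸k]; k>n⇒nCk≡0)
open import Data.Nat.DivMod using (_/_; m/n*n≡m)
open import Data.Nat.ListAction using (sum)
open import Data.Nat.Properties
  using (suc-injective; ≡ᵇ⇒≡; ≡⇒≡ᵇ; ≤-refl; ≤-reflexive; ≤-trans; ≤-pred; <⇒≤; ≰⇒>; >⇒≢; ≤∧≢⇒<;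
         <-irrefl; n≤1+n; n<1+n; m<n⇒m<1+n; m≤m+n; m≤n+m; +-suc; +-mono-≤; +-monoˡ-≤; +-monoʳ-≤;
         +-cancelʳ-≤; +-cancelʳ-<; *-zeroʳ; *-distribˡ-+; *-distribʳ-+; *-cancelˡ-≡; *-cancelʳ-≡;
         m^n>0; n∸n≡0; m+[n∸m]≡n; m∸n+n≡m; m+n∸n≡m; m+n∸m≡n; m∸[m∸n]≡n; m∸n≤m; +-∸-assoc;
         +-∸-comm; ∸-+-assoc; [m+n]∸[m+o]≡n∸o; ∸-monoˡ-≤; ∸-monoʳ-<; m>n⇒m∸n≢0; m<n⇒0<n∸m;
         m≤n⇒m∸n≡0; m*n≢0; _!≢0; _!*_!≢0; +-commutativeSemigroup)
  renaming (+-comm to +-comm-ℕ; +-assoc to +-assoc-ℕ; +-identityʳ to +-identityʳ-ℕ; *-identityʳ to *-identityʳ-ℕ)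
open import Data.Nat.Tactic.RingSolver using (solve-∀)
open import Data.Product using (∃-syntax; _×_; _,_; proj₁; proj₂)
open import Data.Sum using (inj₁; inj₂)
open import Data.Vec as Vec using (Vec; []; _∷_; lookup)
import Data.Vec.Properties as Vec
open import Function using (_∘_; case_of_; _⇔_; mk⇔; Equivalence; _⟨_⟩_)
open import Relation.Binary.Definitions using (DecidableEquality)
open import Relation.Binary.PropositionalEquality as ≡ using (_≡_; _≢_; _≗_; refl; cong; cong₂; sym)
open import Relation.Nullary using (¬_; Dec; T?; does; yes; no)
open import Relation.Nullary.Decidable using (⌊_⌋; toWitness; fromWitness)

open import Defs

open CommSemigroupProperties +-commutativeSemigroup using () renaming (interchange to ℕ-interchange)
open CommSemigroupProperties ℤP.+-commutativeSemigroup using () renaming (interchange to ℤ-interchange)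

T-does : ∀ {P : Set} (d : Dec P) → T (does d) ⇔ P
T-does (yes p) = mk⇔ (λ _ → p) (λ _ → _)
T-does (no ¬p) = mk⇔ (λ ()) ¬p

module _ {A : Set} where

  countWhere-cong : ∀ {p p′ : A → Bool} → p ≗ p′ → ∀ xs → countWhere p xs ≡ countWhere p′ xs
  countWhere-cong p≗p′ [] = refl
  countWhere-cong {p} {p′} p≗p′ (x ∷ xs) rewrite p≗p′ x with p′ x
  ... | true  = cong suc (countWhere-cong p≗p′ xs)
  ... | false = countWhere-cong p≗p′ xs

  countWhere-↭ : ∀ (p : A → Bool) {xs ys} → xs ↭ ys → countWhere p xs ≡ countWhere p ys
  countWhere-↭ p ↭.refl = refl
  countWhere-↭ p (↭.prep x xs↭ys) with p x
  ... | true  = cong suc (countWhere-↭ p xs↭ys)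
  ... | false = countWhere-↭ p xs↭ys
  countWhere-↭ p (↭.swap x y xs↭ys) with p x | p y
  ... | true  | true  = cong (λ c → suc (suc c)) (countWhere-↭ p xs↭ys)
  ... | true  | false = cong suc (countWhere-↭ p xs↭ys)
  ... | false | true  = cong suc (countWhere-↭ p xs↭ys)
  ... | false | false = countWhere-↭ p xs↭ys
  countWhere-↭ p (↭.trans xs↭ys ys↭zs) = ≡.trans (countWhere-↭ p xs↭ys) (countWhere-↭ p ys↭zs)

  countWhere-filterᵇ : ∀ (q p : A → Bool) xs →
    countWhere p (filterᵇ q xs) ≡ countWhere (λ x → q x ∧ p x) xs
  countWhere-filterᵇ q p [] = refl
  countWhere-filterᵇ q p (x ∷ xs) with q x
  ... | false = countWhere-filterᵇ q p xs
  ... | true with p x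
  ...   | true  = cong suc (countWhere-filterᵇ q p xs)
  ...   | false = countWhere-filterᵇ q p xs

  unique-⇔⇒↭ : ∀ {xs ys : List A} → Unique xs → Unique ys → (∀ {x} → x ∈ xs ⇔ x ∈ ys) → xs ↭ ys
  unique-⇔⇒↭ !xs !ys xs⇔ys = ∼bag⇒↭ (unique∧set⇒bag !xs !ys xs⇔ys)

  countWhere-restrict : ∀ (q p : A → Bool) {xs ys} → Unique xs → Unique ys →
    (∀ {x} → x ∈ ys ⇔ (x ∈ xs × T (q x))) →
    countWhere p ys ≡ countWhere (λ x → q x ∧ p x) xs
  countWhere-restrict q p {xs} {ys} !xs !ys ys⇔ = ≡.trans
    (countWhere-↭ p (unique-⇔⇒↭ !ys (Unique.filter⁺ (T? ∘ q) !xs) (λ {x} → mk⇔ to from)))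
    (countWhere-filterᵇ q p xs)
    where
    to : ∀ {x} → x ∈ ys → x ∈ filterᵇ q xs
    to x∈ys = let x∈xs , qx = Equivalence.to ys⇔ x∈ys in ∈-filter⁺ (T? ∘ q) x∈xs qx
    from : ∀ {x} → x ∈ filterᵇ q xs → x ∈ ys
    from x∈ = Equivalence.from ys⇔ (∈-filter⁻ (T? ∘ q) x∈)

  countWhere-map : ∀ {B : Set} (p : B → Bool) (f : A → B) xs → countWhere p (List.map f xs) ≡ countWhere (p ∘ f) xs
  countWhere-map p f []       = refl
  countWhere-map p f (x ∷ xs) with p (f x)
  ... | true  = cong suc (countWhere-map p f xs)
  ... | false = countWhere-map p f xs

  countWhere≡1 : ∀ (p : A → Bool) {xs y} → Unique xs → y ∈ xs → T (p y) →
    (∀ {x} → T (p x) → x ≡ y) → countWhere p xs ≡ 1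
  countWhere≡1 p {xs} {y} !xs y∈xs py unique-p = ≡.trans
    (countWhere-cong (λ x → sym (∧-identityʳ (p x))) xs)
    (sym (countWhere-restrict p (λ _ → true) !xs ([] AllPairs.∷ AllPairs.[]) (mk⇔ to from)))
    where
    to : ∀ {x} → x ∈ y ∷ [] → x ∈ xs × T (p x)
    to (here refl) = y∈xs , py
    from : ∀ {x} → x ∈ xs × T (p x) → x ∈ y ∷ []
    from (_ , px) = here (unique-p px)

  countWhere-∘-bijection : ∀ (p : A → Bool) {xs} (φ : A → A) → Unique xs → (∀ x → x ∈ xs) →
    (∀ {x y} → φ x ≡ φ y → x ≡ y) → (∀ y → ∃[ x ] φ x ≡ y) →
    countWhere (p ∘ φ) xs ≡ countWhere p xs
  countWhere-∘-bijection p {xs} φ !xs complete φ-injective φ-surjective = ≡.trans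
    (sym (countWhere-map p φ xs))
    (countWhere-↭ p (unique-⇔⇒↭ (Unique.map⁺ φ-injective !xs) !xs (mk⇔ (λ _ → complete _) onto)))
    where
    onto : ∀ {y} → y ∈ xs → y ∈ List.map φ xs
    onto {y} _ = let x , φx≡y = φ-surjective y in ≡.subst (_∈ List.map φ xs) φx≡y (∈-map⁺ φ (complete x))

  countWhere-all : ∀ (p : A → Bool) xs → (∀ x → T (p x)) → countWhere p xs ≡ length xs
  countWhere-all p []       _  = refl
  countWhere-all p (x ∷ xs) all-p with p x | all-p x
  ... | true | _ = cong suc (countWhere-all p xs all-p)

  countWhere-none : ∀ (p : A → Bool) xs → (∀ x → ¬ T (p x)) → countWhere p xs ≡ 0
  countWhere-none p []       _   = refl
  countWhere-none p (x ∷ xs) ¬px with p x | ¬px x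
  ... | false | _   = countWhere-none p xs ¬px
  ... | true  | ¬T = ⊥-elim (¬T _)

  countWhere>0 : ∀ (p : A → Bool) xs → 0 < countWhere p xs → ∃[ x ] (x ∈ xs × T (p x))
  countWhere>0 p (x ∷ xs) 0<count with p x in px
  ... | true  = x , here refl , ≡.subst T (sym px) _
  ... | false = let y , y∈xs , py = countWhere>0 p xs 0<count in y , there y∈xs , py

  sum-map-+ : ∀ (f g : A → ℕ) xs → sum (List.map (λ x → f x ℕ.+ g x) xs) ≡ sum (List.map f xs) ℕ.+ sum (List.map g xs)
  sum-map-+ f g []       = refl
  sum-map-+ f g (x ∷ xs) = ≡.trans (cong (f x ℕ.+ g x ℕ.+_) (sum-map-+ f g xs)) (ℕ-interchange (f x) (g x) _ _)

  sum-map-const : ∀ c xs → sum (List.map (λ (_ : A) → c) xs) ≡ length xs ℕ.* c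
  sum-map-const c []       = refl
  sum-map-const c (x ∷ xs) = cong (c ℕ.+_) (sum-map-const c xs)

  sum-map-indicator : ∀ (p : A → Bool) xs → sum (List.map (λ x → if p x then 1 else 0) xs) ≡ countWhere p xs
  sum-map-indicator p []       = refl
  sum-map-indicator p (x ∷ xs) with p x
  ... | true  = cong suc (sum-map-indicator p xs)
  ... | false = sum-map-indicator p xs

module _ {A B : Set} (_≟_ : DecidableEquality B) {values : List B}
         (!values : Unique values) (∈values : ∀ b → b ∈ values) where

  countWhere-partition : ∀ (p : A → Bool) (g : A → B) xs →
    countWhere p xs ≡ sum (List.map (λ b → countWhere (λ x → p x ∧ ⌊ g x ≟ b ⌋) xs) values)
  countWhere-partition p g [] = sym (sum-map-const 0 values ⟨ ≡.trans ⟩ *-zeroʳ (length values))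
  countWhere-partition p g (x ∷ xs) = begin
    countWhere p (x ∷ xs)
      ≡⟨ unfold (p x) ⟩
    (if p x then 1 else 0) ℕ.+ countWhere p xs
      ≡⟨ cong₂ ℕ._+_ (sym (indicators (p x))) (countWhere-partition p g xs) ⟩
    sum (List.map indicator values) ℕ.+ sum (List.map (λ b → countWhere (λ x → p x ∧ ⌊ g x ≟ b ⌋) xs) values)
      ≡⟨ sum-map-+ indicator _ values ⟨
    sum (List.map (λ b → indicator b ℕ.+ countWhere (λ x → p x ∧ ⌊ g x ≟ b ⌋) xs) values)
      ≡⟨ cong sum (List.map-cong (λ b → unfold (p x ∧ ⌊ g x ≟ b ⌋)) values) ⟨
    sum (List.map (λ b → countWhere (λ x → p x ∧ ⌊ g x ≟ b ⌋) (x ∷ xs)) values) ∎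
    where
    open ≡.≡-Reasoning
    unfold : ∀ {c} b → (if b then suc c else c) ≡ (if b then 1 else 0) ℕ.+ c
    unfold true  = refl
    unfold false = refl
    indicator : B → ℕ
    indicator b = if p x ∧ ⌊ g x ≟ b ⌋ then 1 else 0
    indicators : ∀ px → sum (List.map (λ b → if px ∧ ⌊ g x ≟ b ⌋ then 1 else 0) values) ≡ (if px then 1 else 0)
    indicators false = ≡.trans (sum-map-const 0 values) (*-zeroʳ (length values))
    indicators true  = ≡.trans (sum-map-indicator (λ b → ⌊ g x ≟ b ⌋) values)
      (countWhere≡1 (λ b → ⌊ g x ≟ b ⌋) !values (∈values (g x))
        (fromWitness {a? = g x ≟ g x} refl) (λ {b} gx≡b → sym (toWitness {a? = g x ≟ b} gx≡b)))

sumBelow-cong : ∀ m (f g : ℕ → ℤ) → (∀ x → x < m → f x ≡ g x) → sumBelow m f ≡ sumBelow m g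
sumBelow-cong zero    f g f≡g = refl
sumBelow-cong (suc m) f g f≡g = cong₂ ℤ._+_ (sumBelow-cong m f g (λ x x<m → f≡g x (m<n⇒m<1+n x<m))) (f≡g m (n<1+n m))

sumBelow-zero : ∀ m (f : ℕ → ℤ) → (∀ x → x < m → f x ≡ + 0) → sumBelow m f ≡ + 0
sumBelow-zero zero    f f≡0 = refl
sumBelow-zero (suc m) f f≡0 = cong₂ ℤ._+_ (sumBelow-zero m f (λ x x<m → f≡0 x (m<n⇒m<1+n x<m))) (f≡0 m (n<1+n m))

sumBelow-+ : ∀ m (f g : ℕ → ℤ) → sumBelow m (λ x → f x ℤ.+ g x) ≡ sumBelow m f ℤ.+ sumBelow m g
sumBelow-+ zero    f g = refl
sumBelow-+ (suc m) f g = ≡.trans (cong (ℤ._+ (f m ℤ.+ g m)) (sumBelow-+ m f g))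
  (ℤ-interchange (sumBelow m f) (sumBelow m g) (f m) (g m))

sumBelow-*ˡ : ∀ m c (f : ℕ → ℤ) → c ℤ.* sumBelow m f ≡ sumBelow m (λ x → c ℤ.* f x)
sumBelow-*ˡ zero    c f = ℤP.*-zeroʳ c
sumBelow-*ˡ (suc m) c f = ≡.trans (ℤP.*-distribˡ-+ c (sumBelow m f) (f m)) (cong (ℤ._+ c ℤ.* f m) (sumBelow-*ˡ m c f))

sumBelow-*ʳ : ∀ m c (f : ℕ → ℤ) → sumBelow m f ℤ.* c ≡ sumBelow m (λ x → f x ℤ.* c)
sumBelow-*ʳ m c f = ≡.trans (ℤP.*-comm (sumBelow m f) c)
  (≡.trans (sumBelow-*ˡ m c f) (sumBelow-cong m _ _ (λ x _ → ℤP.*-comm c (f x))))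

sumBelow-++ : ∀ a b (f : ℕ → ℤ) → sumBelow (a ℕ.+ b) f ≡ sumBelow a f ℤ.+ sumBelow b (λ x → f (a ℕ.+ x))
sumBelow-++ a zero    f = ≡.trans (cong (λ m → sumBelow m f) (+-identityʳ-ℕ a)) (sym (ℤP.+-identityʳ _))
sumBelow-++ a (suc b) f = ≡.trans (cong (λ m → sumBelow m f) (+-suc a b))
  (≡.trans (cong (ℤ._+ f (a ℕ.+ b)) (sumBelow-++ a b f)) (ℤP.+-assoc (sumBelow a f) _ _))

sumBelow-triangle : ∀ N (h : ℕ → ℕ → ℤ) →
  sumBelow N (λ j → sumBelow (suc j) (h j)) ≡ sumBelow N (λ l → sumBelow (N ∸ l) (λ s → h (l ℕ.+ s) l))
sumBelow-triangle zero    h = refl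
sumBelow-triangle (suc N) h = begin
  sumBelow N (λ j → sumBelow (suc j) (h j)) ℤ.+ sumBelow (suc N) (h N)
    ≡⟨ cong (ℤ._+ sumBelow (suc N) (h N)) (sumBelow-triangle N h) ⟩
  sumBelow N column ℤ.+ sumBelow (suc N) (h N)
    ≡⟨ cong (ℤ._+ sumBelow (suc N) (h N))
         (sym (≡.trans (cong (ℤ._+_ (sumBelow N column)) last-empty) (ℤP.+-identityʳ (sumBelow N column)))) ⟩
  sumBelow (suc N) column ℤ.+ sumBelow (suc N) (h N)
    ≡⟨ sumBelow-+ (suc N) column (h N) ⟨
  sumBelow (suc N) (λ l → column l ℤ.+ h N l)
    ≡⟨ sumBelow-cong (suc N) _ _ extend ⟩
  sumBelow (suc N) (λ l → sumBelow (suc N ∸ l) (λ s → h (l ℕ.+ s) l)) ∎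
  where
  open ≡.≡-Reasoning
  column : ℕ → ℤ
  column l = sumBelow (N ∸ l) (λ s → h (l ℕ.+ s) l)
  last-empty : column N ≡ + 0
  last-empty = cong (λ m → sumBelow m (λ s → h (N ℕ.+ s) N)) (n∸n≡0 N)
  extend : ∀ l → l < suc N → column l ℤ.+ h N l ≡ sumBelow (suc N ∸ l) (λ s → h (l ℕ.+ s) l)
  extend l (s≤s l≤N) = ≡.trans
    (cong (λ z → column l ℤ.+ h z l) (sym (m+[n∸m]≡n l≤N)))
    (cong (λ m → sumBelow m (λ s → h (l ℕ.+ s) l)) (sym (+-∸-assoc 1 l≤N)))

indicator-≢ : ∀ {x w} → x ≢ w → (if x ≡ᵇ w then 1 else 0) ≡ 0
indicator-≢ {x} {w} x≢w with x ≡ᵇ w in x≡ᵇw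
... | true  = ⊥-elim (x≢w (≡ᵇ⇒≡ x w (≡.subst T (sym x≡ᵇw) _)))
... | false = refl

sumBelow-kronecker : ∀ N (f : ℕ → ℕ) x → x < N → sumBelow N (λ w → + (f w ℕ.* (if x ≡ᵇ w then 1 else 0))) ≡ + f x
sumBelow-kronecker (suc N) f x x<1+N with x ≡ᵇ N in x≡ᵇN
... | true with refl ← ≡ᵇ⇒≡ x N (≡.subst T (sym x≡ᵇN) _) = ≡.trans
      (cong₂ ℤ._+_ (sumBelow-zero N _ (λ w w<N →
                      cong (λ i → + (f w ℕ.* i)) (indicator-≢ (>⇒≢ w<N)) ⟨ ≡.trans ⟩ cong +_ (*-zeroʳ (f w))))
                   (cong +_ (*-identityʳ-ℕ (f x))))
      (ℤP.+-identityˡ _)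
... | false = ≡.trans
      (cong₂ ℤ._+_ (sumBelow-kronecker N f x (≤∧≢⇒< (≤-pred x<1+N) λ x≡N → ≡.subst T x≡ᵇN (≡⇒≡ᵇ x N x≡N)))
                   (cong +_ (*-zeroʳ (f N))))
      (ℤP.+-identityʳ _)

sum-map-by-value : ∀ {A : Set} (f : ℕ → ℕ) (h : A → ℕ) N xs → (∀ x → h x ≤ N) →
  + sum (List.map (f ∘ h) xs) ≡ sumBelow (suc N) (λ w → + (f w ℕ.* countWhere (λ x → h x ≡ᵇ w) xs))
sum-map-by-value f h N [] _ = sym (sumBelow-zero (suc N) _ (λ w _ → cong +_ (*-zeroʳ (f w))))
sum-map-by-value f h N (x ∷ xs) h≤N = begin
  + (f (h x) ℕ.+ sum (List.map (f ∘ h) xs))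
    ≡⟨ ℤP.pos-+ (f (h x)) _ ⟩
  + f (h x) ℤ.+ + sum (List.map (f ∘ h) xs)
    ≡⟨ cong₂ ℤ._+_ (sym (sumBelow-kronecker (suc N) f (h x) (s≤s (h≤N x)))) (sum-map-by-value f h N xs h≤N) ⟩
  sumBelow (suc N) (λ w → + (f w ℕ.* (if h x ≡ᵇ w then 1 else 0))) ℤ.+
  sumBelow (suc N) (λ w → + (f w ℕ.* countWhere (λ x → h x ≡ᵇ w) xs))
    ≡⟨ sumBelow-+ (suc N) _ _ ⟨
  sumBelow (suc N) (λ w → + (f w ℕ.* (if h x ≡ᵇ w then 1 else 0)) ℤ.+ + (f w ℕ.* countWhere (λ x → h x ≡ᵇ w) xs))
    ≡⟨ sumBelow-cong (suc N) _ _ (λ w _ → ≡.trans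
         (sym (ℤP.pos-+ (f w ℕ.* (if h x ≡ᵇ w then 1 else 0)) (f w ℕ.* countWhere (λ x → h x ≡ᵇ w) xs)))
         (cong +_ (step w))) ⟩
  sumBelow (suc N) (λ w → + (f w ℕ.* countWhere (λ x → h x ≡ᵇ w) (x ∷ xs))) ∎
  where
  open ≡.≡-Reasoning
  step : ∀ w → f w ℕ.* (if h x ≡ᵇ w then 1 else 0) ℕ.+ f w ℕ.* countWhere (λ x → h x ≡ᵇ w) xs
             ≡ f w ℕ.* countWhere (λ x → h x ≡ᵇ w) (x ∷ xs)
  step w with h x ≡ᵇ w
  ... | true  = sym (*-distribˡ-+ (f w) 1 _)
  ... | false = cong (ℕ._+ f w ℕ.* countWhere (λ x → h x ≡ᵇ w) xs) (*-zeroʳ (f w))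

module _ where
  open import Data.Nat using (_+_; _*_; _!)

  [m+n]Cm*m!*n!≡[m+n]! : ∀ m n → ((m + n) C m) * (m ! * n !) ≡ (m + n) !
  [m+n]Cm*m!*n!≡[m+n]! m n = begin
    ((m + n) C m) * (m ! * n !)          ≡⟨ cong (λ z → ((m + n) C m) * (m ! * z !)) (m+n∸m≡n m n) ⟨
    ((m + n) C m) * D                    ≡⟨ cong (_* D) (nCk≡n!/k![n-k]! (m≤m+n m n)) ⟩
    (m + n) ! / D * D                  ≡⟨ m/n*n≡m (k![n∸k]!∣n! (m≤m+n m n)) ⟩
    (m + n) !                          ∎
    where
    open ≡.≡-Reasoning
    D = m ! * ((m + n) ∸ m) !
    instance _ = m !* ((m + n) ∸ m) !≢0

  [d+e]Cd*[s+d+e]Cs≡[s+d+e]C[s+d]*[s+d]Cs : ∀ s d e →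
    ((d + e) C d) * ((s + d + e) C s) ≡ ((s + d + e) C (s + d)) * ((s + d) C s)
  [d+e]Cd*[s+d+e]Cs≡[s+d+e]C[s+d]*[s+d]Cs s d e = *-cancelʳ-≡ _ _ (s ! * (d ! * e !)) (≡.trans lhs (sym rhs))
    where
    open ≡.≡-Reasoning
    instance _ = m*n≢0 (s !) (d ! * e !) {{s !≢0}} {{d !* e !≢0}}
    lhs : ((d + e) C d) * ((s + d + e) C s) * (s ! * (d ! * e !)) ≡ (s + d + e) !
    lhs = begin
      ((d + e) C d) * ((s + d + e) C s) * (s ! * (d ! * e !))
        ≡⟨ cong (λ z → ((d + e) C d) * (z C s) * (s ! * (d ! * e !))) (+-assoc-ℕ s d e) ⟩
      ((d + e) C d) * ((s + (d + e)) C s) * (s ! * (d ! * e !))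
        ≡⟨ regroup ((d + e) C d) ((s + (d + e)) C s) (s !) (d !) (e !) ⟩
      ((s + (d + e)) C s) * (s ! * (((d + e) C d) * (d ! * e !)))
        ≡⟨ cong (λ z → ((s + (d + e)) C s) * (s ! * z)) ([m+n]Cm*m!*n!≡[m+n]! d e) ⟩
      ((s + (d + e)) C s) * (s ! * (d + e) !)
        ≡⟨ [m+n]Cm*m!*n!≡[m+n]! s (d + e) ⟩
      (s + (d + e)) !
        ≡⟨ cong _! (+-assoc-ℕ s d e) ⟨
      (s + d + e) ! ∎
      where
      regroup : ∀ x y a b c → x * y * (a * (b * c)) ≡ y * (a * (x * (b * c)))
      regroup = solve-∀
    rhs : ((s + d + e) C (s + d)) * ((s + d) C s) * (s ! * (d ! * e !)) ≡ (s + d + e) !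
    rhs = begin
      ((s + d + e) C (s + d)) * ((s + d) C s) * (s ! * (d ! * e !))
        ≡⟨ regroup ((s + d + e) C (s + d)) ((s + d) C s) (s !) (d !) (e !) ⟩
      ((s + d + e) C (s + d)) * (((s + d) C s) * (s ! * d !) * e !)
        ≡⟨ cong (λ z → ((s + d + e) C (s + d)) * (z * e !)) ([m+n]Cm*m!*n!≡[m+n]! s d) ⟩
      ((s + d + e) C (s + d)) * ((s + d) ! * e !)
        ≡⟨ [m+n]Cm*m!*n!≡[m+n]! (s + d) e ⟩
      (s + d + e) ! ∎
      where
      regroup : ∀ x y a b c → x * y * (a * (b * c)) ≡ x * (y * (a * b) * c)
      regroup = solve-∀

module _ where
  open import Data.Integer using (_+_; _*_)

  sign : ℕ → ℤ
  sign m = -[1+ 0 ] ℤ.^ m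

  isZero : ℕ → ℤ
  isZero zero    = + 1
  isZero (suc _) = + 0

  sign-∸ : ∀ r s → s ≤ r → sign (r ∸ s) ≡ sign r * sign s
  sign-∸ r s s≤r = begin
    sign (r ∸ s)                    ≡⟨ ℤP.*-identityʳ _ ⟨
    sign (r ∸ s) * + 1              ≡⟨ cong (sign (r ∸ s) *_) (square s) ⟨
    sign (r ∸ s) * (sign s * sign s) ≡⟨ ℤP.*-assoc (sign (r ∸ s)) (sign s) (sign s) ⟨
    sign (r ∸ s) * sign s * sign s  ≡⟨ cong (_* sign s) (ℤP.^-distribˡ-+-* -[1+ 0 ] (r ∸ s) s) ⟨
    sign (r ∸ s ℕ.+ s) * sign s     ≡⟨ cong (λ m → sign m * sign s) (m∸n+n≡m s≤r) ⟩
    sign r * sign s                 ∎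
    where
    open ≡.≡-Reasoning
    square : ∀ m → sign m * sign m ≡ + 1
    square zero    = refl
    square (suc m) = ≡.trans (flip-twice (sign m)) (square m)
      where
      flip-twice : ∀ x → -[1+ 0 ] * x * (-[1+ 0 ] * x) ≡ x * x
      flip-twice = solve-∀ℤ

  alternating-prefix : ∀ r m → sumBelow (suc m) (λ s → sign s * + ((suc r) C s)) ≡ sign m * + (r C m)
  alternating-prefix r zero    = refl
  alternating-prefix r (suc m) = begin
    sumBelow (suc m) (λ s → sign s * + (suc r C s)) + sign (suc m) * + (suc r C suc m)
      ≡⟨ cong₂ _+_ (alternating-prefix r m) (cong (λ c → sign (suc m) * + c) (sym (nCk+nC[k+1]≡[n+1]C[k+1] r m))) ⟩
    sign m * + (r C m) + -[1+ 0 ] * sign m * + ((r C m) ℕ.+ (r C suc m))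
      ≡⟨ cong (λ z → sign m * + (r C m) + -[1+ 0 ] * sign m * z) (ℤP.pos-+ (r C m) (r C suc m)) ⟩
    sign m * + (r C m) + -[1+ 0 ] * sign m * (+ (r C m) + + (r C suc m))
      ≡⟨ telescope (sign m) (+ (r C m)) (+ (r C suc m)) ⟩
    -[1+ 0 ] * sign m * + (r C suc m) ∎
    where
    open ≡.≡-Reasoning
    telescope : ∀ x a b → x * a + -[1+ 0 ] * x * (a + b) ≡ -[1+ 0 ] * x * b
    telescope = solve-∀ℤ

  alternating-sum : ∀ r → sumBelow (suc r) (λ s → sign (r ∸ s) * + (r C s)) ≡ isZero r
  alternating-sum zero    = refl
  alternating-sum (suc r) = begin
    sumBelow (2 ℕ.+ r) (λ s → sign (suc r ∸ s) * + (suc r C s))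
      ≡⟨ sumBelow-cong (2 ℕ.+ r) _ _ (λ s s<2+r →
           ≡.trans (cong (_* + (suc r C s)) (sign-∸ (suc r) s (≤-pred s<2+r))) (ℤP.*-assoc (sign (suc r)) (sign s) _)) ⟩
    sumBelow (2 ℕ.+ r) (λ s → sign (suc r) * (sign s * + (suc r C s)))
      ≡⟨ sumBelow-*ˡ (2 ℕ.+ r) (sign (suc r)) _ ⟨
    sign (suc r) * sumBelow (2 ℕ.+ r) (λ s → sign s * + (suc r C s))
      ≡⟨ cong (sign (suc r) *_) (alternating-prefix r (suc r)) ⟩
    sign (suc r) * (sign (suc r) * + (r C suc r))
      ≡⟨ cong (λ c → sign (suc r) * (sign (suc r) * + c)) (k>n⇒nCk≡0 (n<1+n r)) ⟩
    sign (suc r) * (sign (suc r) * + 0)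
      ≡⟨ cong (sign (suc r) *_) (ℤP.*-zeroʳ (sign (suc r))) ⟩
    sign (suc r) * + 0
      ≡⟨ ℤP.*-zeroʳ (sign (suc r)) ⟩
    + 0 ∎
    where open ≡.≡-Reasoning

  [r+e∸s]C[r∸s]*[r+e]Cs≡[r+e]Cr*rCs : ∀ r e s → s ≤ r →
    ((r ℕ.+ e ∸ s) C (r ∸ s)) ℕ.* ((r ℕ.+ e) C s) ≡ ((r ℕ.+ e) C r) ℕ.* (r C s)
  [r+e∸s]C[r∸s]*[r+e]Cs≡[r+e]Cr*rCs r e s s≤r = begin
    ((r ℕ.+ e ∸ s) C (r ∸ s)) ℕ.* ((r ℕ.+ e) C s)
      ≡⟨ cong₂ (λ x y → (x C (r ∸ s)) ℕ.* (y C s)) (+-∸-comm e s≤r) (cong (ℕ._+ e) (sym (m+[n∸m]≡n s≤r))) ⟩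
    ((r ∸ s ℕ.+ e) C (r ∸ s)) ℕ.* ((s ℕ.+ (r ∸ s) ℕ.+ e) C s)
      ≡⟨ [d+e]Cd*[s+d+e]Cs≡[s+d+e]C[s+d]*[s+d]Cs s (r ∸ s) e ⟩
    ((s ℕ.+ (r ∸ s) ℕ.+ e) C (s ℕ.+ (r ∸ s))) ℕ.* ((s ℕ.+ (r ∸ s)) C s)
      ≡⟨ cong (λ z → ((z ℕ.+ e) C z) ℕ.* (z C s)) (m+[n∸m]≡n s≤r) ⟩
    ((r ℕ.+ e) C r) ℕ.* (r C s) ∎
    where open ≡.≡-Reasoning

  alternating-subset-sum : ∀ r e →
    sumBelow (suc r) (λ s → sign (r ∸ s) * + ((r ℕ.+ e ∸ s) C (r ∸ s)) * + ((r ℕ.+ e) C s)) ≡ + ((r ℕ.+ e) C r) * isZero r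
  alternating-subset-sum r e = begin
    sumBelow (suc r) (λ s → sign (r ∸ s) * + ((r ℕ.+ e ∸ s) C (r ∸ s)) * + ((r ℕ.+ e) C s))
      ≡⟨ sumBelow-cong (suc r) _ _ (λ s s<1+r → factor s (≤-pred s<1+r)) ⟩
    sumBelow (suc r) (λ s → + ((r ℕ.+ e) C r) * (sign (r ∸ s) * + (r C s)))
      ≡⟨ sumBelow-*ˡ (suc r) (+ ((r ℕ.+ e) C r)) _ ⟨
    + ((r ℕ.+ e) C r) * sumBelow (suc r) (λ s → sign (r ∸ s) * + (r C s))
      ≡⟨ cong (+ ((r ℕ.+ e) C r) *_) (alternating-sum r) ⟩
    + ((r ℕ.+ e) C r) * isZero r ∎
    where
    open ≡.≡-Reasoning
    factor : ∀ s → s ≤ r → sign (r ∸ s) * + ((r ℕ.+ e ∸ s) C (r ∸ s)) * + ((r ℕ.+ e) C s)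
                         ≡ + ((r ℕ.+ e) C r) * (sign (r ∸ s) * + (r C s))
    factor s s≤r = begin
      sign (r ∸ s) * + ((r ℕ.+ e ∸ s) C (r ∸ s)) * + ((r ℕ.+ e) C s)
        ≡⟨ ℤP.*-assoc (sign (r ∸ s)) _ _ ⟩
      sign (r ∸ s) * (+ ((r ℕ.+ e ∸ s) C (r ∸ s)) * + ((r ℕ.+ e) C s))
        ≡⟨ cong (sign (r ∸ s) *_) (ℤP.pos-* ((r ℕ.+ e ∸ s) C (r ∸ s)) ((r ℕ.+ e) C s)) ⟨
      sign (r ∸ s) * + (((r ℕ.+ e ∸ s) C (r ∸ s)) ℕ.* ((r ℕ.+ e) C s))
        ≡⟨ cong (λ c → sign (r ∸ s) * + c) ([r+e∸s]C[r∸s]*[r+e]Cs≡[r+e]Cr*rCs r e s s≤r) ⟩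
      sign (r ∸ s) * + (((r ℕ.+ e) C r) ℕ.* (r C s))
        ≡⟨ cong (sign (r ∸ s) *_) (ℤP.pos-* ((r ℕ.+ e) C r) (r C s)) ⟩
      sign (r ∸ s) * (+ ((r ℕ.+ e) C r) * + (r C s))
        ≡⟨ exchange (sign (r ∸ s)) (+ ((r ℕ.+ e) C r)) (+ (r C s)) ⟩
      + ((r ℕ.+ e) C r) * (sign (r ∸ s) * + (r C s)) ∎
      where
      exchange : ∀ x a b → x * (a * b) ≡ a * (x * b)
      exchange = solve-∀ℤ

  inversion-coefficient : ∀ K i l → l ≤ i → i ≤ K →
    sumBelow (suc i ∸ l) (λ s → sign (i ∸ (l ℕ.+ s)) * + ((K ∸ (l ℕ.+ s)) C (i ∸ (l ℕ.+ s)))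
                              * + ((K ∸ l) C (K ∸ (l ℕ.+ s))))
    ≡ + ((K ∸ l) C (i ∸ l)) * isZero (i ∸ l)
  inversion-coefficient K i l l≤i i≤K = begin
    sumBelow (suc i ∸ l) term
      ≡⟨ cong (λ m → sumBelow m term) (+-∸-assoc 1 l≤i) ⟩
    sumBelow (suc r) term
      ≡⟨ sumBelow-cong (suc r) _ _ (λ s s<1+r → reindex s (≤-pred s<1+r)) ⟩
    sumBelow (suc r) (λ s → sign (r ∸ s) * + ((r ℕ.+ e ∸ s) C (r ∸ s)) * + ((r ℕ.+ e) C s))
      ≡⟨ alternating-subset-sum r e ⟩
    + ((r ℕ.+ e) C r) * isZero r
      ≡⟨ cong (λ m → + (m C r) * isZero r) r+e≡K∸l ⟩
    + ((K ∸ l) C (i ∸ l)) * isZero (i ∸ l) ∎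
    where
    open ≡.≡-Reasoning
    r = i ∸ l
    e = K ∸ i
    term : ℕ → ℤ
    term s = sign (i ∸ (l ℕ.+ s)) * + ((K ∸ (l ℕ.+ s)) C (i ∸ (l ℕ.+ s))) * + ((K ∸ l) C (K ∸ (l ℕ.+ s)))
    r+e≡K∸l : r ℕ.+ e ≡ K ∸ l
    r+e≡K∸l = ≡.trans (sym (+-∸-comm (K ∸ i) l≤i)) (cong (_∸ l) (m+[n∸m]≡n i≤K))
    K∸[l+s]≡r+e∸s : ∀ s → K ∸ (l ℕ.+ s) ≡ r ℕ.+ e ∸ s
    K∸[l+s]≡r+e∸s s = ≡.trans (sym (∸-+-assoc K l s)) (cong (_∸ s) (sym r+e≡K∸l))
    reindex : ∀ s → s ≤ r → term s ≡ sign (r ∸ s) * + ((r ℕ.+ e ∸ s) C (r ∸ s)) * + ((r ℕ.+ e) C s)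
    reindex s s≤r = cong₂ _*_
      (cong₂ (λ a b → sign a * + (b C a)) (sym (∸-+-assoc i l s)) (K∸[l+s]≡r+e∸s s))
      (cong +_ (begin
        (K ∸ l) C (K ∸ (l ℕ.+ s))        ≡⟨ cong₂ _C_ (sym r+e≡K∸l) (K∸[l+s]≡r+e∸s s) ⟩
        (r ℕ.+ e) C (r ℕ.+ e ∸ s)        ≡⟨ nCk≡nC[n∸k] (≤-trans s≤r (m≤m+n r e)) ⟨
        (r ℕ.+ e) C s                    ∎))

  binomial-inversion : ∀ K (y R : ℕ → ℤ) →
    (∀ j → j ≤ K → R j ≡ sumBelow (suc j) (λ l → + ((K ∸ l) C (K ∸ j)) * y l)) →
    ∀ i → i ≤ K → y i ≡ sumBelow (suc i) (λ j → sign (i ∸ j) * + ((K ∸ j) C (i ∸ j)) * R j)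
  binomial-inversion K y R R≡ i i≤K = sym (begin
    sumBelow (suc i) (λ j → c j * R j)
      ≡⟨ sumBelow-cong (suc i) _ _ (λ j j<1+i → cong (c j *_) (R≡ j (≤-trans (≤-pred j<1+i) i≤K))) ⟩
    sumBelow (suc i) (λ j → c j * sumBelow (suc j) (λ l → L j l * y l))
      ≡⟨ sumBelow-cong (suc i) _ _ (λ j _ → sumBelow-*ˡ (suc j) (c j) _) ⟩
    sumBelow (suc i) (λ j → sumBelow (suc j) (λ l → c j * (L j l * y l)))
      ≡⟨ sumBelow-triangle (suc i) (λ j l → c j * (L j l * y l)) ⟩
    sumBelow (suc i) (λ l → sumBelow (suc i ∸ l) (λ s → c (l ℕ.+ s) * (L (l ℕ.+ s) l * y l)))
      ≡⟨ sumBelow-cong (suc i) _ _ (λ l l<1+i → collect l (≤-pred l<1+i)) ⟩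
    sumBelow (suc i) (λ l → + ((K ∸ l) C (i ∸ l)) * isZero (i ∸ l) * y l)
      ≡⟨ cong₂ _+_ (sumBelow-zero i _ (λ l l<i → vanish l l<i)) diagonal ⟩
    + 0 + y i
      ≡⟨ ℤP.+-identityˡ (y i) ⟩
    y i ∎)
    where
    open ≡.≡-Reasoning
    c : ℕ → ℤ
    c j = sign (i ∸ j) * + ((K ∸ j) C (i ∸ j))
    L : ℕ → ℕ → ℤ
    L j l = + ((K ∸ l) C (K ∸ j))
    collect : ∀ l → l ≤ i → sumBelow (suc i ∸ l) (λ s → c (l ℕ.+ s) * (L (l ℕ.+ s) l * y l))
                          ≡ + ((K ∸ l) C (i ∸ l)) * isZero (i ∸ l) * y l
    collect l l≤i = begin
      sumBelow (suc i ∸ l) (λ s → c (l ℕ.+ s) * (L (l ℕ.+ s) l * y l))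
        ≡⟨ sumBelow-cong (suc i ∸ l) _ _ (λ s _ → sym (ℤP.*-assoc (c (l ℕ.+ s)) _ (y l))) ⟩
      sumBelow (suc i ∸ l) (λ s → c (l ℕ.+ s) * L (l ℕ.+ s) l * y l)
        ≡⟨ sumBelow-*ʳ (suc i ∸ l) (y l) _ ⟨
      sumBelow (suc i ∸ l) (λ s → c (l ℕ.+ s) * L (l ℕ.+ s) l) * y l
        ≡⟨ cong (_* y l) (inversion-coefficient K i l l≤i i≤K) ⟩
      + ((K ∸ l) C (i ∸ l)) * isZero (i ∸ l) * y l ∎
    vanish : ∀ l → l < i → + ((K ∸ l) C (i ∸ l)) * isZero (i ∸ l) * y l ≡ + 0
    vanish l l<i with i ∸ l | m>n⇒m∸n≢0 l<i
    ... | zero  | i∸l≢0 = ⊥-elim (i∸l≢0 refl)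
    ... | suc m | _     = cong (_* y l) (ℤP.*-zeroʳ (+ ((K ∸ l) C suc m)))
    diagonal : + ((K ∸ i) C (i ∸ i)) * isZero (i ∸ i) * y i ≡ y i
    diagonal rewrite n∸n≡0 i = ℤP.*-identityˡ (y i)

∣S∣≡1+s⇒remove : ∀ {n} (S : Subset n) s → ∣ S ∣ ≡ suc s →
  ∃[ j ] (lookup S j ≡ inside × ∣ S Vec.[ j ]≔ outside ∣ ≡ s)
∣S∣≡1+s⇒remove (inside ∷ S) s ∣S∣≡1+s = zero , refl , suc-injective ∣S∣≡1+s
∣S∣≡1+s⇒remove (outside ∷ S) s ∣S∣≡1+s =
  let j , j∈S , ∣S-j∣≡s = ∣S∣≡1+s⇒remove S s ∣S∣≡1+s in suc j , j∈S , ∣S-j∣≡s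

∣insert∣ : ∀ {n} (S : Subset n) j → lookup S j ≡ outside → ∣ S Vec.[ j ]≔ inside ∣ ≡ suc ∣ S ∣
∣insert∣ (outside ∷ S) zero    refl = refl
∣insert∣ (inside ∷ S)  (suc j) j∉S  = cong suc (∣insert∣ S j j∉S)
∣insert∣ (outside ∷ S) (suc j) j∉S  = ∣insert∣ S j j∉S

remove-⊆ : ∀ {n} (S : Subset n) j i → lookup (S Vec.[ j ]≔ outside) i ≡ inside → i ≢ j × lookup S i ≡ inside
remove-⊆ S j i i∈S′ with i Fin.≟ j
... | yes refl = case ≡.trans (sym (Vec.lookup∘updateAt j S)) i∈S′ of λ ()
... | no  i≢j  = i≢j , ≡.trans (sym (Vec.lookup∘updateAt′ i j i≢j S)) i∈S′

module VectorSpace {q : ℕ} (𝔽 : FiniteField q) where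
  open FiniteField 𝔽
  open Code 𝔽

  field-ring : CommutativeRing 0ℓ 0ℓ
  field-ring = record { isCommutativeRing = isCommRing }

  open CommutativeRing field-ring public
    using (+-assoc; +-comm; +-identityˡ; +-identityʳ; -‿inverseˡ; -‿inverseʳ;
           *-assoc; *-comm; *-identityˡ; *-identityʳ; distribˡ; distribʳ; zeroˡ; zeroʳ)
  open RingProperties (CommutativeRing.ring field-ring) public
    using (-0#≈0#; +-cancelʳ; -‿involutive; -‿+-comm; -‿distribˡ-*; x∙y⁻¹≈ε⇒x≈y)
  open CommSemigroupProperties (CommutativeRing.+-commutativeSemigroup field-ring)
    using () renaming (interchange to +-interchange)

  infixl 6 _⊕_
  infixr 7 _·_

  _⊕_ : ∀ {n} → Vec F n → Vec F n → Vec F n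
  _⊕_ = Vec.zipWith _+_

  ⊝_ : ∀ {n} → Vec F n → Vec F n
  ⊝_ = Vec.map -_

  _·_ : ∀ {n} → F → Vec F n → Vec F n
  a · x = Vec.map (a *_) x

  ⊕-isAbelianGroup : ∀ n → IsAbelianGroup _≡_ (_⊕_ {n}) (zeroVec n) ⊝_
  ⊕-isAbelianGroup n = record
    { isGroup = record
      { isMonoid = record
        { isSemigroup = record
          { isMagma = record { isEquivalence = ≡.isEquivalence ; ∙-cong = cong₂ _⊕_ }
          ; assoc = Vec.zipWith-assoc +-assoc }
        ; identity = Vec.zipWith-identityˡ +-identityˡ , Vec.zipWith-identityʳ +-identityʳ }
      ; inverse = Vec.zipWith-inverseˡ -‿inverseˡ , Vec.zipWith-inverseʳ -‿inverseʳ
      ; ⁻¹-cong = cong ⊝_ }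
    ; comm = Vec.zipWith-comm +-comm }

  ⊕-abelianGroup : ℕ → AbelianGroup 0ℓ 0ℓ
  ⊕-abelianGroup n = record { isAbelianGroup = ⊕-isAbelianGroup n }

  module _ {n : ℕ} where
    open AbelianGroup (⊕-abelianGroup n) public
      using () renaming (identityˡ to ⊕-identityˡ; identityʳ to ⊕-identityʳ; assoc to ⊕-assoc; inverseˡ to ⊕-inverseˡ)
    open AbelianGroupProperties (⊕-abelianGroup n) public
      using () renaming (∙-cancelʳ to ⊕-cancelʳ; ⁻¹-∙-comm to ⊝-⊕-comm; ε⁻¹≈ε to ⊝-zero)
    open CommSemigroupProperties (AbelianGroup.commutativeSemigroup (⊕-abelianGroup n)) public
      using () renaming (interchange to ⊕-interchange)

  ·-zeroʳ : ∀ {n} a → a · zeroVec n ≡ zeroVec n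
  ·-zeroʳ {n} a = ≡.trans (Vec.map-replicate (a *_) 0# n) (cong (Vec.replicate n) (zeroʳ a))

  ·-zeroˡ : ∀ {n} (x : Vec F n) → 0# · x ≡ zeroVec n
  ·-zeroˡ []      = refl
  ·-zeroˡ (c ∷ x) = cong₂ _∷_ (zeroˡ c) (·-zeroˡ x)

  ·-distribˡ-⊕ : ∀ {n} a (x y : Vec F n) → a · (x ⊕ y) ≡ a · x ⊕ a · y
  ·-distribˡ-⊕ a []      []      = refl
  ·-distribˡ-⊕ a (b ∷ x) (c ∷ y) = cong₂ _∷_ (distribˡ a b c) (·-distribˡ-⊕ a x y)

  ·-distribʳ-+ : ∀ {n} a b (x : Vec F n) → (a + b) · x ≡ a · x ⊕ b · x
  ·-distribʳ-+ a b []      = refl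
  ·-distribʳ-+ a b (c ∷ x) = cong₂ _∷_ (distribʳ c a b) (·-distribʳ-+ a b x)

  *-· : ∀ {n} a b (x : Vec F n) → (a * b) · x ≡ a · b · x
  *-· a b []      = refl
  *-· a b (c ∷ x) = cong₂ _∷_ (*-assoc a b c) (*-· a b x)

  -‿· : ∀ {n} a (x : Vec F n) → (- a) · x ≡ ⊝ (a · x)
  -‿· a []      = refl
  -‿· a (c ∷ x) = cong₂ _∷_ (sym (-‿distribˡ-* a c)) (-‿· a x)

  encode-⊕ : ∀ {n k} (G : Vec (Vec F n) k) m m′ → encode G (m ⊕ m′) ≡ encode G m ⊕ encode G m′
  encode-⊕ {n} [] [] [] = sym (⊕-identityˡ (zeroVec n))
  encode-⊕ (g ∷ G) (a ∷ m) (b ∷ m′) = begin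
    (a + b) · g ⊕ encode G (m ⊕ m′)               ≡⟨ cong₂ _⊕_ (·-distribʳ-+ a b g) (encode-⊕ G m m′) ⟩
    (a · g ⊕ b · g) ⊕ (encode G m ⊕ encode G m′)   ≡⟨ ⊕-interchange _ _ _ _ ⟩
    (a · g ⊕ encode G m) ⊕ (b · g ⊕ encode G m′)   ∎
    where open ≡.≡-Reasoning

  encode-· : ∀ {n k} (G : Vec (Vec F n) k) a m → encode G (a · m) ≡ a · encode G m
  encode-· [] a [] = sym (·-zeroʳ a)
  encode-· (g ∷ G) a (b ∷ m) = begin
    (a * b) · g ⊕ encode G (a · m)   ≡⟨ cong₂ _⊕_ (*-· a b g) (encode-· G a m) ⟩
    a · b · g ⊕ a · encode G m       ≡⟨ ·-distribˡ-⊕ a _ _ ⟨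
    a · (b · g ⊕ encode G m)         ∎
    where open ≡.≡-Reasoning

  encode-⊝ : ∀ {n k} (G : Vec (Vec F n) k) m → encode G (⊝ m) ≡ ⊝ encode G m
  encode-⊝ [] [] = sym ⊝-zero
  encode-⊝ (g ∷ G) (b ∷ m) = ≡.trans (cong₂ _⊕_ (-‿· b g) (encode-⊝ G m)) (⊝-⊕-comm _ _)

  encode-zero : ∀ {n k} (G : Vec (Vec F n) k) → encode G (zeroVec k) ≡ zeroVec n
  encode-zero [] = refl
  encode-zero {n} (g ∷ G) = ≡.trans (cong₂ _⊕_ (·-zeroˡ g) (encode-zero G)) (⊕-identityˡ (zeroVec n))

  encode-encode : ∀ {n k r} (G : Vec (Vec F n) k) (R : Vec (Vec F k) r) a →
    encode G (encode R a) ≡ encode (Vec.map (encode G) R) a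
  encode-encode G []      []       = encode-zero G
  encode-encode G (m ∷ R) (a ∷ as) =
    ≡.trans (encode-⊕ G _ _) (cong₂ _⊕_ (encode-· G a m) (encode-encode G R as))

  unitVec : ∀ {n} → Fin n → Vec F n
  unitVec {suc n} zero    = 1# ∷ zeroVec n
  unitVec         (suc j) = 0# ∷ unitVec j

  lookup-zeroVec : ∀ {n} (i : Fin n) → lookup (zeroVec n) i ≡ 0#
  lookup-zeroVec i = Vec.lookup-replicate i 0#

  lookup-unitVec-diag : ∀ {n} (j : Fin n) → lookup (unitVec j) j ≡ 1#
  lookup-unitVec-diag zero    = refl
  lookup-unitVec-diag (suc j) = lookup-unitVec-diag j

  lookup-unitVec-sym : ∀ {n} (i p : Fin n) → lookup (unitVec i) p ≡ lookup (unitVec p) i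
  lookup-unitVec-sym zero    zero    = refl
  lookup-unitVec-sym zero    (suc p) = lookup-zeroVec p
  lookup-unitVec-sym (suc i) zero    = sym (lookup-zeroVec i)
  lookup-unitVec-sym (suc i) (suc p) = lookup-unitVec-sym i p

  lookup-⊕ : ∀ {n} (x y : Vec F n) i → lookup (x ⊕ y) i ≡ lookup x i + lookup y i
  lookup-⊕ x y i = Vec.lookup-zipWith _+_ i x y

  lookup-· : ∀ {n} a (x : Vec F n) i → lookup (a · x) i ≡ a * lookup x i
  lookup-· a x i = Vec.lookup-map i (a *_) x

  lookup-⊝ : ∀ {n} (x : Vec F n) i → lookup (⊝ x) i ≡ - lookup x i
  lookup-⊝ x i = Vec.lookup-map i -_ x

  dot-zeroˡ : ∀ {n} (y : Vec F n) → dot (zeroVec n) y ≡ 0#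
  dot-zeroˡ []       = refl
  dot-zeroˡ (y ∷ ys) = ≡.trans (cong₂ _+_ (zeroˡ y) (dot-zeroˡ ys)) (+-identityˡ 0#)

  dot-⊕ˡ : ∀ {n} (x y z : Vec F n) → dot (x ⊕ y) z ≡ dot x z + dot y z
  dot-⊕ˡ [] [] [] = sym (+-identityˡ 0#)
  dot-⊕ˡ (a ∷ x) (b ∷ y) (c ∷ z) =
    ≡.trans (cong₂ _+_ (distribʳ c a b) (dot-⊕ˡ x y z)) (+-interchange _ _ _ _)

  dot-⊝ˡ : ∀ {n} (x z : Vec F n) → dot (⊝ x) z ≡ - dot x z
  dot-⊝ˡ [] [] = sym -0#≈0#
  dot-⊝ˡ (a ∷ x) (c ∷ z) = ≡.trans (cong₂ _+_ (sym (-‿distribˡ-* a c)) (dot-⊝ˡ x z)) (-‿+-comm _ _)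

  dot-unitVecˡ : ∀ {n} j (c : Vec F n) → dot (unitVec j) c ≡ lookup c j
  dot-unitVecˡ zero    (c ∷ cs) = ≡.trans (cong₂ _+_ (*-identityˡ c) (dot-zeroˡ cs)) (+-identityʳ c)
  dot-unitVecˡ (suc j) (c ∷ cs) = ≡.trans (cong₂ _+_ (zeroˡ c) (dot-unitVecˡ j cs)) (+-identityˡ _)

  lookup-encode : ∀ {n r} (R : Vec (Vec F n) r) a p →
    lookup (encode R a) p ≡ dot a (Vec.map (λ row → lookup row p) R)
  lookup-encode []      []       p = lookup-zeroVec p
  lookup-encode (g ∷ R) (a ∷ as) p =
    ≡.trans (lookup-⊕ (a · g) _ p) (cong₂ _+_ (lookup-· a g p) (lookup-encode R as p))

  -- The summand of Defs.wt, so that wt (a ∷ x) reduces to wt₁ a ℕ.+ wt x.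
  wt₁ : F → ℕ
  wt₁ a = if does (a ≟ 0#) then 0 else 1

  wt₁-≡0 : ∀ {a} → a ≡ 0# → wt₁ a ≡ 0
  wt₁-≡0 {a} a≡0 with a ≟ 0#
  ... | yes _   = refl
  ... | no  a≢0 = ⊥-elim (a≢0 a≡0)

  wt₁-≢0 : ∀ {a} → a ≢ 0# → wt₁ a ≡ 1
  wt₁-≢0 {a} a≢0 with a ≟ 0#
  ... | yes a≡0 = ⊥-elim (a≢0 a≡0)
  ... | no  _   = refl

  wt₁≤1 : ∀ a → wt₁ a ≤ 1
  wt₁≤1 a with a ≟ 0#
  ... | yes _ = z≤n
  ... | no  _ = ≤-refl

  wt₁-+ : ∀ a b → wt₁ (a + b) ≤ wt₁ a ℕ.+ wt₁ b
  wt₁-+ a b with a ≟ 0#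
  ... | yes refl = ≤-reflexive (cong wt₁ (+-identityˡ b))
  ... | no  _    = ≤-trans (wt₁≤1 (a + b)) (m≤m+n 1 (wt₁ b))

  wt₁-- : ∀ a → wt₁ (- a) ≡ wt₁ a
  wt₁-- a with a ≟ 0#
  ... | yes a≡0 = wt₁-≡0 (≡.trans (cong -_ a≡0) -0#≈0#)
  ... | no  a≢0 = wt₁-≢0 λ -a≡0 → a≢0 (≡.trans (sym (-‿involutive a)) (≡.trans (cong -_ -a≡0) -0#≈0#))

  wt-zeroVec : ∀ n → wt (zeroVec n) ≡ 0
  wt-zeroVec zero    = refl
  wt-zeroVec (suc n) = cong₂ ℕ._+_ (wt₁-≡0 refl) (wt-zeroVec n)

  wt≡0⇒≡zeroVec : ∀ {n} (x : Vec F n) → wt x ≡ 0 → x ≡ zeroVec n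
  wt≡0⇒≡zeroVec []      _    = refl
  wt≡0⇒≡zeroVec (a ∷ x) wt≡0 with a ≟ 0#
  ... | yes a≡0 = cong₂ _∷_ a≡0 (wt≡0⇒≡zeroVec x wt≡0)

  lookup≢0⇒≢zeroVec : ∀ {n} (x : Vec F n) j → lookup x j ≢ 0# → x ≢ zeroVec n
  lookup≢0⇒≢zeroVec x j xⱼ≢0 x≡0 = xⱼ≢0 (≡.trans (cong (λ z → lookup z j) x≡0) (lookup-zeroVec j))

  wt≤length : ∀ {n} (x : Vec F n) → wt x ≤ n
  wt≤length []      = z≤n
  wt≤length (a ∷ x) = +-mono-≤ (wt₁≤1 a) (wt≤length x)

  wt-⊕ : ∀ {n} (x y : Vec F n) → wt (x ⊕ y) ≤ wt x ℕ.+ wt y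
  wt-⊕ []      []      = z≤n
  wt-⊕ (a ∷ x) (b ∷ y) = ≤-trans (+-mono-≤ (wt₁-+ a b) (wt-⊕ x y))
                                 (≤-reflexive (ℕ-interchange (wt₁ a) (wt₁ b) (wt x) (wt y)))

  wt-⊝ : ∀ {n} (x : Vec F n) → wt (⊝ x) ≡ wt x
  wt-⊝ []      = refl
  wt-⊝ (a ∷ x) = cong₂ ℕ._+_ (wt₁-- a) (wt-⊝ x)

  wt-unitVec : ∀ {n} (j : Fin n) → wt (unitVec j) ≡ 1
  wt-unitVec {suc n} zero = cong₂ ℕ._+_ (wt₁-≢0 (0≢1 ∘ sym)) (wt-zeroVec n)
  wt-unitVec (suc j)      = cong₂ ℕ._+_ (wt₁-≡0 refl) (wt-unitVec j)

  ∈-allVecs : ∀ n (x : Vec F n) → x ∈ allVecs n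
  ∈-allVecs zero    []      = here refl
  ∈-allVecs (suc n) (a ∷ x) = go elements (complete a)
    where
    go : ∀ E → a ∈ E → (a ∷ x) ∈ concatMap (λ b → List.map (b ∷_) (allVecs n)) E
    go (b ∷ E) (here refl) = ∈-++⁺ˡ (∈-map⁺ (a ∷_) (∈-allVecs n x))
    go (b ∷ E) (there a∈E) = ∈-++⁺ʳ (List.map (b ∷_) (allVecs n)) (go E a∈E)

  allVecs-unique : ∀ n → Unique (allVecs n)
  allVecs-unique zero    = [] AllPairs.∷ AllPairs.[]
  allVecs-unique (suc n) = go elements unique
    where
    head∈ : ∀ E {x} → x ∈ concatMap (λ b → List.map (b ∷_) (allVecs n)) E → Vec.head x ∈ E
    head∈ (b ∷ E) x∈ with ∈-++⁻ (List.map (b ∷_) (allVecs n)) x∈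
    ... | inj₁ x∈b∷ with ∈-map⁻ _ x∈b∷
    ...   | _ , _ , refl = here refl
    head∈ (b ∷ E) x∈ | inj₂ x∈E = there (head∈ E x∈E)
    go : ∀ E → Unique E → Unique (concatMap (λ b → List.map (b ∷_) (allVecs n)) E)
    go []      _          = AllPairs.[]
    go (b ∷ E) (b∉E AllPairs.∷ !E) = Unique.++⁺ (Unique.map⁺ Vec.∷-injectiveʳ (allVecs-unique n)) (go E !E) disjoint
      where
      disjoint : ∀ {x} → x ∈ List.map (b ∷_) (allVecs n) × x ∈ concatMap (λ b → List.map (b ∷_) (allVecs n)) E → ⊥
      disjoint (x∈b∷ , x∈E) with ∈-map⁻ _ x∈b∷
      ... | _ , _ , refl = All¬⇒¬Any b∉E (head∈ E x∈E)

  length-allVecs : ∀ n → length (allVecs n) ≡ q ^ n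
  length-allVecs zero    = refl
  length-allVecs (suc n) = ≡.trans (go elements) (cong (ℕ._* q ^ n) size)
    where
    go : ∀ E → length (concatMap (λ b → List.map (b ∷_) (allVecs n)) E) ≡ length E ℕ.* q ^ n
    go []      = refl
    go (b ∷ E) = ≡.trans (List.length-++ (List.map (b ∷_) (allVecs n)))
                         (cong₂ ℕ._+_ (≡.trans (List.length-map (b ∷_) (allVecs n)) (length-allVecs n)) (go E))

  agreesOn : ∀ {n} → Subset n → Vec F n → Vec F n → Bool
  agreesOn []            []       []       = true
  agreesOn (inside ∷ S)  (x ∷ xs) (y ∷ ys) = ⌊ x ≟ y ⌋ ∧ agreesOn S xs ys
  agreesOn (outside ∷ S) (_ ∷ xs) (_ ∷ ys) = agreesOn S xs ys

  agreesOn⇒≡ : ∀ {n} (S : Subset n) x y → T (agreesOn S x y) →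
    ∀ i → lookup S i ≡ inside → lookup x i ≡ lookup y i
  agreesOn⇒≡ (inside ∷ S) (a ∷ x) (b ∷ y) agree zero refl =
    toWitness {a? = a ≟ b} (proj₁ (Equivalence.to T-∧ agree))
  agreesOn⇒≡ (inside ∷ S)  (a ∷ x) (b ∷ y) agree (suc i) i∈S =
    agreesOn⇒≡ S x y (proj₂ (Equivalence.to T-∧ agree)) i i∈S
  agreesOn⇒≡ (outside ∷ S) (a ∷ x) (b ∷ y) agree (suc i) i∈S = agreesOn⇒≡ S x y agree i i∈S

  ≡⇒agreesOn : ∀ {n} (S : Subset n) x y →
    (∀ i → lookup S i ≡ inside → lookup x i ≡ lookup y i) → T (agreesOn S x y)
  ≡⇒agreesOn []            []      []      _  = _
  ≡⇒agreesOn (inside ∷ S)  (a ∷ x) (b ∷ y) eq =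
    Equivalence.from T-∧ (fromWitness {a? = a ≟ b} (eq zero refl) , ≡⇒agreesOn S x y (eq ∘ suc))
  ≡⇒agreesOn (outside ∷ S) (a ∷ x) (b ∷ y) eq = ≡⇒agreesOn S x y (eq ∘ suc)

  agreesOn-remove : ∀ {n} (S : Subset n) j x y → lookup S j ≡ inside →
    agreesOn S x y ≡ agreesOn (S Vec.[ j ]≔ outside) x y ∧ ⌊ lookup x j ≟ lookup y j ⌋
  agreesOn-remove (inside ∷ S) zero (a ∷ x) (b ∷ y) refl = ∧-comm ⌊ a ≟ b ⌋ (agreesOn S x y)
  agreesOn-remove (inside ∷ S) (suc j) (a ∷ x) (b ∷ y) j∈S =
    ≡.trans (cong (⌊ a ≟ b ⌋ ∧_) (agreesOn-remove S j x y j∈S)) (sym (∧-assoc ⌊ a ≟ b ⌋ _ _))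
  agreesOn-remove (outside ∷ S) (suc j) (a ∷ x) (b ∷ y) j∈S = agreesOn-remove S j x y j∈S

  agreesOn-insert : ∀ {n} (S : Subset n) j x y → lookup S j ≡ outside →
    agreesOn (S Vec.[ j ]≔ inside) x y ≡ agreesOn S x y ∧ ⌊ lookup x j ≟ lookup y j ⌋
  agreesOn-insert S j x y j∉S = begin
    agreesOn (S Vec.[ j ]≔ inside) x y
      ≡⟨ agreesOn-remove (S Vec.[ j ]≔ inside) j x y (Vec.lookup∘updateAt j S) ⟩
    agreesOn ((S Vec.[ j ]≔ inside) Vec.[ j ]≔ outside) x y ∧ _
      ≡⟨ cong (λ S′ → agreesOn S′ x y ∧ _) (≡.trans (Vec.[]≔-idempotent S j) restore) ⟩
    agreesOn S x y ∧ ⌊ lookup x j ≟ lookup y j ⌋ ∎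
    where
    open ≡.≡-Reasoning
    restore : S Vec.[ j ]≔ outside ≡ S
    restore = ≡.trans (cong (S Vec.[ j ]≔_) (sym j∉S)) (Vec.[]≔-lookup S j)

  agreesOn-empty : ∀ {n} (S : Subset n) x y → ∣ S ∣ ≡ 0 → T (agreesOn S x y)
  agreesOn-empty []            []      []      _ = _
  agreesOn-empty (outside ∷ S) (_ ∷ x) (_ ∷ y) ∣S∣≡0 = agreesOn-empty S x y ∣S∣≡0

  restrict : ∀ {n} → Subset n → Vec F n → Vec F n
  restrict []            []       = []
  restrict (inside ∷ S)  (x ∷ xs) = x ∷ restrict S xs
  restrict (outside ∷ S) (_ ∷ xs) = 0# ∷ restrict S xs

  lookup-restrict-inside : ∀ {n} (S : Subset n) x i → lookup S i ≡ inside → lookup (restrict S x) i ≡ lookup x i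
  lookup-restrict-inside (inside ∷ S)  (a ∷ x) zero    refl = refl
  lookup-restrict-inside (inside ∷ S)  (a ∷ x) (suc i) i∈S  = lookup-restrict-inside S x i i∈S
  lookup-restrict-inside (outside ∷ S) (a ∷ x) (suc i) i∈S  = lookup-restrict-inside S x i i∈S

  lookup-restrict-outside : ∀ {n} (S : Subset n) x i → lookup S i ≡ outside → lookup (restrict S x) i ≡ 0#
  lookup-restrict-outside (outside ∷ S) (a ∷ x) zero    refl = refl
  lookup-restrict-outside (inside ∷ S)  (a ∷ x) (suc i) i∉S  = lookup-restrict-outside S x i i∉S
  lookup-restrict-outside (outside ∷ S) (a ∷ x) (suc i) i∉S  = lookup-restrict-outside S x i i∉S

  wt-restrict : ∀ {n} (S : Subset n) x → wt (restrict S x) ≤ ∣ S ∣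
  wt-restrict []            []      = z≤n
  wt-restrict (inside ∷ S)  (a ∷ x) = +-mono-≤ (wt₁≤1 a) (wt-restrict S x)
  wt-restrict (outside ∷ S) (a ∷ x) = ≤-trans (≤-reflexive (cong (ℕ._+ wt (restrict S x)) (wt₁-≡0 refl))) (wt-restrict S x)

  dot-comm : ∀ {n} (x y : Vec F n) → dot x y ≡ dot y x
  dot-comm []      []      = refl
  dot-comm (a ∷ x) (b ∷ y) = cong₂ _+_ (*-comm a b) (dot-comm x y)

  dot-restrict-swap : ∀ {n} (S : Subset n) x y → dot (restrict S x) y ≡ dot (restrict S y) x
  dot-restrict-swap []            []      []      = refl
  dot-restrict-swap (inside ∷ S)  (a ∷ x) (b ∷ y) = cong₂ _+_ (*-comm a b) (dot-restrict-swap S x y)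
  dot-restrict-swap (outside ∷ S) (a ∷ x) (b ∷ y) =
    cong₂ _+_ (≡.trans (zeroˡ b) (sym (zeroˡ a))) (dot-restrict-swap S x y)

  dot-restrict-cong : ∀ {n} (S : Subset n) c y z → T (agreesOn S y z) → dot (restrict S c) y ≡ dot (restrict S c) z
  dot-restrict-cong []            []      []      []      _     = refl
  dot-restrict-cong (inside ∷ S)  (a ∷ c) (b ∷ y) (b′ ∷ z) agree =
    cong₂ (λ u v → a * u + v) (agreesOn⇒≡ (inside ∷ S) (b ∷ y) (b′ ∷ z) agree zero refl)
          (dot-restrict-cong S c y z (proj₂ (Equivalence.to T-∧ agree)))
  dot-restrict-cong (outside ∷ S) (a ∷ c) (b ∷ y) (b′ ∷ z) agree =
    cong₂ _+_ (≡.trans (zeroˡ b) (sym (zeroˡ b′))) (dot-restrict-cong S c y z agree)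

  zerosIn : ∀ {n} → Subset n → Vec F n → ℕ
  zerosIn []            []       = 0
  zerosIn (inside ∷ M)  (x ∷ xs) = (if ⌊ x ≟ 0# ⌋ then 1 else 0) ℕ.+ zerosIn M xs
  zerosIn (outside ∷ M) (_ ∷ xs) = zerosIn M xs

  zerosIn-empty : ∀ {n} (M : Subset n) x → ∣ M ∣ ≡ 0 → zerosIn M x ≡ 0
  zerosIn-empty []            []      _     = refl
  zerosIn-empty (outside ∷ M) (_ ∷ x) ∣M∣≡0 = zerosIn-empty M x ∣M∣≡0

  zerosIn-remove : ∀ {n} (M : Subset n) j x → lookup M j ≡ inside →
    zerosIn M x ≡ zerosIn (M Vec.[ j ]≔ outside) x ℕ.+ (if ⌊ lookup x j ≟ 0# ⌋ then 1 else 0)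
  zerosIn-remove (inside ∷ M)  zero    (a ∷ x) refl = +-comm-ℕ _ (zerosIn M x)
  zerosIn-remove (inside ∷ M)  (suc j) (a ∷ x) j∈M  =
    ≡.trans (cong (z₁ ℕ.+_) (zerosIn-remove M j x j∈M)) (sym (+-assoc-ℕ z₁ _ _))
    where z₁ = if ⌊ a ≟ 0# ⌋ then 1 else 0
  zerosIn-remove (outside ∷ M) (suc j) (a ∷ x) j∈M  = zerosIn-remove M j x j∈M

  zerosIn-⊤+wt : ∀ {n} (x : Vec F n) → zerosIn ⊤ x ℕ.+ wt x ≡ n
  zerosIn-⊤+wt []      = refl
  zerosIn-⊤+wt (a ∷ x) with a ≟ 0#
  ... | yes _ = cong suc (zerosIn-⊤+wt x)
  ... | no  _ = ≡.trans (+-suc (zerosIn ⊤ x) (wt x)) (cong suc (zerosIn-⊤+wt x))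

  agreesOn-⊕-vanishing : ∀ {n} (S : Subset n) x y v → T (agreesOn S y (zeroVec n)) →
    agreesOn S (x ⊕ y) v ≡ agreesOn S x v
  agreesOn-⊕-vanishing []            []      []      []      _ = refl
  agreesOn-⊕-vanishing (inside ∷ S)  (a ∷ x) (b ∷ y) (c ∷ v) y≈0 =
    cong₂ _∧_ (cong (λ z → ⌊ z ≟ c ⌋) (≡.trans (cong (_+_ a) b≡0) (+-identityʳ a)))
              (agreesOn-⊕-vanishing S x y v (proj₂ (Equivalence.to T-∧ y≈0)))
    where b≡0 = toWitness {a? = b ≟ 0#} (proj₁ (Equivalence.to T-∧ y≈0))
  agreesOn-⊕-vanishing (outside ∷ S) (a ∷ x) (b ∷ y) (c ∷ v) y≈0 = agreesOn-⊕-vanishing S x y v y≈0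

  agreesOn-·-vanishing : ∀ {n} (S : Subset n) a y → T (agreesOn S y (zeroVec n)) → T (agreesOn S (a · y) (zeroVec n))
  agreesOn-·-vanishing S a y y≈0 = ≡⇒agreesOn S (a · y) (zeroVec _) λ i i∈S → begin
    lookup (a · y) i       ≡⟨ lookup-· a y i ⟩
    a * lookup y i         ≡⟨ cong (a *_) (≡.trans (agreesOn⇒≡ S y _ y≈0 i i∈S) (lookup-zeroVec i)) ⟩
    a * 0#                 ≡⟨ zeroʳ a ⟩
    0#                     ≡⟨ lookup-zeroVec i ⟨
    lookup (zeroVec _) i   ∎
    where open ≡.≡-Reasoning

module LinearCode {q : ℕ} (𝔽 : FiniteField q) {n k : ℕ} (G : Vec (Vec (FiniteField.F 𝔽) n) k) where
  open FiniteField 𝔽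
  open Code 𝔽
  open VectorSpace 𝔽

  Distance≥ DualDistance≥ : ℕ → Set
  Distance≥ d = ∀ x → InCode G x → x ≢ zeroVec n → d ≤ wt x
  DualDistance≥ d = ∀ u → InDual G u → u ≢ zeroVec n → d ≤ wt u

  messages : List (Vec F k)
  messages = allVecs k

  agreementCount : Subset n → Vec F n → ℕ
  agreementCount S v = countWhere (λ m → agreesOn S (encode G m) v) messages

  fibreCount : Subset n → Vec F n → Fin n → F → ℕ
  fibreCount S v j a = countWhere (λ m → agreesOn S (encode G m) v ∧ ⌊ lookup (encode G m) j ≟ a ⌋) messages

  q≢0 : q ≢ 0
  q≢0 q≡0 with elements | complete 0# | size
  ... | _ ∷ _ | _ | size′ = case ≡.trans size′ q≡0 of λ ()

  fibreCount-translate : ∀ (S : Subset n) j m₀ → T (agreesOn S (encode G m₀) (zeroVec n)) → lookup (encode G m₀) j ≡ 1# →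
    ∀ v a → fibreCount S v j a ≡ fibreCount S v j 0#
  fibreCount-translate S j m₀ c₀≈0 c₀ⱼ≡1 v a = ≡.trans
    (sym (countWhere-∘-bijection _ shift (allVecs-unique k) (∈-allVecs k) (⊕-cancelʳ _ _ _) unshift))
    (countWhere-cong shifted messages)
    where
    open ≡.≡-Reasoning
    shift : Vec F k → Vec F k
    shift m = m ⊕ a · m₀
    unshift : ∀ m → ∃[ m′ ] shift m′ ≡ m
    unshift m = m ⊕ ⊝ (a · m₀) , (begin
      m ⊕ ⊝ (a · m₀) ⊕ a · m₀      ≡⟨ ⊕-assoc m _ _ ⟩
      m ⊕ (⊝ (a · m₀) ⊕ a · m₀)    ≡⟨ cong (m ⊕_) (⊕-inverseˡ (a · m₀)) ⟩
      m ⊕ zeroVec k                ≡⟨ ⊕-identityʳ m ⟩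
      m                            ∎)
    encode-shift : ∀ m → encode G (shift m) ≡ encode G m ⊕ a · encode G m₀
    encode-shift m = ≡.trans (encode-⊕ G m (a · m₀)) (cong (encode G m ⊕_) (encode-· G a m₀))
    coordinate : ∀ m → lookup (encode G (shift m)) j ≡ lookup (encode G m) j + a
    coordinate m = begin
      lookup (encode G (shift m)) j                      ≡⟨ cong (λ c → lookup c j) (encode-shift m) ⟩
      lookup (encode G m ⊕ a · encode G m₀) j            ≡⟨ lookup-⊕ (encode G m) _ j ⟩
      lookup (encode G m) j + lookup (a · encode G m₀) j ≡⟨ cong (_+_ (lookup (encode G m) j)) (lookup-· a (encode G m₀) j) ⟩
      lookup (encode G m) j + a * lookup (encode G m₀) j ≡⟨ cong (λ z → lookup (encode G m) j + a * z) c₀ⱼ≡1 ⟩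
      lookup (encode G m) j + a * 1#                     ≡⟨ cong (_+_ (lookup (encode G m) j)) (*-identityʳ a) ⟩
      lookup (encode G m) j + a                          ∎
    +a≟a : ∀ x → ⌊ (x + a) ≟ a ⌋ ≡ ⌊ x ≟ 0# ⌋
    +a≟a x with x ≟ 0# | (x + a) ≟ a
    ... | yes _    | yes _     = refl
    ... | no  _    | no  _     = refl
    ... | yes refl | no  0+a≢a = ⊥-elim (0+a≢a (+-identityˡ a))
    ... | no  x≢0  | yes x+a≡a = ⊥-elim (x≢0 (+-cancelʳ a x 0# (≡.trans x+a≡a (sym (+-identityˡ a)))))
    shifted : ∀ m → agreesOn S (encode G (shift m)) v ∧ ⌊ lookup (encode G (shift m)) j ≟ a ⌋
                  ≡ agreesOn S (encode G m) v ∧ ⌊ lookup (encode G m) j ≟ 0# ⌋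
    shifted m = cong₂ _∧_
      (≡.trans (cong (λ c → agreesOn S c v) (encode-shift m))
               (agreesOn-⊕-vanishing S _ _ v (agreesOn-·-vanishing S a _ c₀≈0)))
      (≡.trans (cong (λ z → ⌊ z ≟ a ⌋) (coordinate m)) (+a≟a (lookup (encode G m) j)))

  agreementCount-insert : ∀ (S : Subset n) j m₀ → lookup S j ≡ outside →
    T (agreesOn S (encode G m₀) (zeroVec n)) → lookup (encode G m₀) j ≡ 1# →
    ∀ v → q ℕ.* agreementCount (S Vec.[ j ]≔ inside) v ≡ agreementCount S v
  agreementCount-insert S j m₀ j∉S c₀≈0 c₀ⱼ≡1 v = sym (begin
    agreementCount S v
      ≡⟨ countWhere-partition _≟_ unique complete _ (λ m → lookup (encode G m) j) messages ⟩
    sum (List.map (fibreCount S v j) elements)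
      ≡⟨ cong sum (List.map-cong (λ a → ≡.trans (translate a) (sym (translate (lookup v j)))) elements) ⟩
    sum (List.map (λ _ → fibreCount S v j (lookup v j)) elements)
      ≡⟨ sum-map-const (fibreCount S v j (lookup v j)) elements ⟩
    length elements ℕ.* fibreCount S v j (lookup v j)
      ≡⟨ cong₂ ℕ._*_ size (countWhere-cong (λ m → sym (agreesOn-insert S j (encode G m) v j∉S)) messages) ⟩
    q ℕ.* agreementCount (S Vec.[ j ]≔ inside) v ∎)
    where
    open ≡.≡-Reasoning
    translate = fibreCount-translate S j m₀ c₀≈0 c₀ⱼ≡1 v

  lookup-encode-tabulate : ∀ (r : Fin n → Vec F k) a p →
    lookup (encode G (encode (Vec.tabulate r) a)) p ≡ dot a (Vec.tabulate (λ i → lookup (encode G (r i)) p))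
  lookup-encode-tabulate r a p = begin
    lookup (encode G (encode (Vec.tabulate r) a)) p
      ≡⟨ cong (λ c → lookup c p) (encode-encode G (Vec.tabulate r) a) ⟩
    lookup (encode (Vec.map (encode G) (Vec.tabulate r)) a) p
      ≡⟨ lookup-encode (Vec.map (encode G) (Vec.tabulate r)) a p ⟩
    dot a (Vec.map (λ row → lookup row p) (Vec.map (encode G) (Vec.tabulate r)))
      ≡⟨ cong (dot a) (≡.trans (sym (Vec.map-∘ _ (encode G) (Vec.tabulate r))) (sym (Vec.tabulate-∘ _ r))) ⟩
    dot a (Vec.tabulate (λ i → lookup (encode G (r i)) p)) ∎
    where open ≡.≡-Reasoning

  noWitness⇒vanishing : ∀ (S : Subset n) j →
    (∀ m → T (agreesOn S (encode G m) (zeroVec n)) → lookup (encode G m) j ≢ 1#) →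
    ∀ w → T (agreesOn S (encode G w) (zeroVec n)) → lookup (encode G w) j ≡ 0#
  noWitness⇒vanishing S j no-witness w w≈0 with lookup (encode G w) j ≟ 0#
  ... | yes wⱼ≡0 = wⱼ≡0
  ... | no  wⱼ≢0 = let y , wⱼy≡1 = inverse _ wⱼ≢0 in ⊥-elim (no-witness (y · w)
    (≡.subst (λ x → T (agreesOn S x (zeroVec n))) (sym (encode-· G y w)) (agreesOn-·-vanishing S y _ w≈0))
    (begin
      lookup (encode G (y · w)) j   ≡⟨ cong (λ x → lookup x j) (encode-· G y w) ⟩
      lookup (y · encode G w) j     ≡⟨ lookup-· y (encode G w) j ⟩
      y * lookup (encode G w) j     ≡⟨ *-comm y _ ⟩
      lookup (encode G w) j * y     ≡⟨ wⱼy≡1 ⟩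
      1#                            ∎))
    where open ≡.≡-Reasoning

  noWitness⇒combination : ∀ (S : Subset n) j →
    (∀ v → ∃[ m ] T (agreesOn S (encode G m) v)) →
    (∀ m → T (agreesOn S (encode G m) (zeroVec n)) → lookup (encode G m) j ≢ 1#) →
    ∃[ coefficients ] ∀ m → lookup (encode G m) j ≡ dot (restrict S (encode G m)) coefficients
  noWitness⇒combination S j onto no-witness = column j , λ m →
    x∙y⁻¹≈ε⇒x≈y _ _ (≡.trans (sym (lookup-correction m j))
                              (noWitness⇒vanishing S j no-witness (correction m) (correction≈0 m)))
    where
    open ≡.≡-Reasoning
    r : Fin n → Vec F k
    r i = proj₁ (onto (unitVec i))
    column : Fin n → Vec F n
    column p = Vec.tabulate (λ i → lookup (encode G (r i)) p)
    dot-column : ∀ p → lookup S p ≡ inside → ∀ c → dot (restrict S c) (column p) ≡ lookup c p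
    dot-column p p∈S c = begin
      dot (restrict S c) (column p)    ≡⟨ dot-restrict-cong S c _ _ column≈unitVec ⟩
      dot (restrict S c) (unitVec p)   ≡⟨ dot-comm (restrict S c) _ ⟩
      dot (unitVec p) (restrict S c)   ≡⟨ dot-unitVecˡ p (restrict S c) ⟩
      lookup (restrict S c) p          ≡⟨ lookup-restrict-inside S c p p∈S ⟩
      lookup c p                       ∎
      where
      column≈unitVec : T (agreesOn S (column p) (unitVec p))
      column≈unitVec = ≡⇒agreesOn S _ _ λ i _ → begin
        lookup (column p) i         ≡⟨ Vec.lookup∘tabulate _ i ⟩
        lookup (encode G (r i)) p   ≡⟨ agreesOn⇒≡ S _ _ (proj₂ (onto (unitVec i))) p p∈S ⟩
        lookup (unitVec i) p        ≡⟨ lookup-unitVec-sym i p ⟩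
        lookup (unitVec p) i        ∎
    correction : Vec F k → Vec F k
    correction m = m ⊕ ⊝ encode (Vec.tabulate r) (restrict S (encode G m))
    lookup-correction : ∀ m p →
      lookup (encode G (correction m)) p ≡ lookup (encode G m) p + - dot (restrict S (encode G m)) (column p)
    lookup-correction m p = begin
      lookup (encode G (correction m)) p
        ≡⟨ cong (λ x → lookup x p) (≡.trans (encode-⊕ G m _) (cong (encode G m ⊕_) (encode-⊝ G _))) ⟩
      lookup (encode G m ⊕ ⊝ encode G (encode (Vec.tabulate r) (restrict S (encode G m)))) p
        ≡⟨ lookup-⊕ (encode G m) _ p ⟩
      lookup (encode G m) p + lookup (⊝ encode G (encode (Vec.tabulate r) (restrict S (encode G m)))) p
        ≡⟨ cong (_+_ (lookup (encode G m) p)) (≡.trans (lookup-⊝ (encode G (encode (Vec.tabulate r) (restrict S (encode G m)))) p)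
                                                     (cong -_ (lookup-encode-tabulate r (restrict S (encode G m)) p))) ⟩
      lookup (encode G m) p + - dot (restrict S (encode G m)) (column p) ∎
    correction≈0 : ∀ m → T (agreesOn S (encode G (correction m)) (zeroVec n))
    correction≈0 m = ≡⇒agreesOn S _ _ λ p p∈S → begin
      lookup (encode G (correction m)) p
        ≡⟨ lookup-correction m p ⟩
      lookup (encode G m) p + - dot (restrict S (encode G m)) (column p)
        ≡⟨ cong (λ x → lookup (encode G m) p + - x) (dot-column p p∈S _) ⟩
      lookup (encode G m) p + - lookup (encode G m) p
        ≡⟨ -‿inverseʳ _ ⟩
      0#
        ≡⟨ lookup-zeroVec p ⟨
      lookup (zeroVec n) p ∎

  combination⇒shortDualWord : ∀ (S : Subset n) j → lookup S j ≡ outside → ∀ coefficients →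
    (∀ m → lookup (encode G m) j ≡ dot (restrict S (encode G m)) coefficients) →
    ∃[ u ] (InDual G u × u ≢ zeroVec n × wt u ≤ suc ∣ S ∣)
  combination⇒shortDualWord S j j∉S coefficients cⱼ≡ = u , u∈C⊥ , lookup≢0⇒≢zeroVec u j uⱼ≢0 , wt-u
    where
    open ≡.≡-Reasoning
    u : Vec F n
    u = restrict S coefficients ⊕ ⊝ unitVec j
    u∈C⊥ : InDual G u
    u∈C⊥ _ (m , refl) = begin
      dot u (encode G m)
        ≡⟨ dot-⊕ˡ (restrict S coefficients) _ (encode G m) ⟩
      dot (restrict S coefficients) (encode G m) + dot (⊝ unitVec j) (encode G m)
        ≡⟨ cong₂ _+_ (dot-restrict-swap S coefficients (encode G m)) (dot-⊝ˡ (unitVec j) (encode G m)) ⟩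
      dot (restrict S (encode G m)) coefficients + - dot (unitVec j) (encode G m)
        ≡⟨ cong₂ (λ x y → x + - y) (sym (cⱼ≡ m)) (dot-unitVecˡ j (encode G m)) ⟩
      lookup (encode G m) j + - lookup (encode G m) j
        ≡⟨ -‿inverseʳ _ ⟩
      0# ∎
    uⱼ≢0 : lookup u j ≢ 0#
    uⱼ≢0 uⱼ≡0 = 0≢1 (begin
      0#                         ≡⟨ -0#≈0# ⟨
      - 0#                       ≡⟨ cong -_ uⱼ≡0 ⟨
      - lookup u j               ≡⟨ cong -_ (lookup-⊕ (restrict S coefficients) _ j) ⟩
      - (lookup (restrict S coefficients) j + lookup (⊝ unitVec j) j)
        ≡⟨ cong -_ (cong₂ _+_ (lookup-restrict-outside S coefficients j j∉S)
                              (≡.trans (lookup-⊝ (unitVec j) j) (cong -_ (lookup-unitVec-diag j)))) ⟩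
      - (0# + - 1#)              ≡⟨ cong -_ (+-identityˡ (- 1#)) ⟩
      - - 1#                     ≡⟨ -‿involutive 1# ⟩
      1#                         ∎)
    wt-u : wt u ≤ suc ∣ S ∣
    wt-u = ≤-trans (wt-⊕ (restrict S coefficients) _)
             (≤-trans (+-mono-≤ (wt-restrict S coefficients) (≤-reflexive (≡.trans (wt-⊝ (unitVec j)) (wt-unitVec j))))
                      (≤-reflexive (+-comm-ℕ ∣ S ∣ 1)))

  agreementCount-step : ∀ {d} → DualDistance≥ d →
    ∀ (S : Subset n) j → lookup S j ≡ outside → suc ∣ S ∣ < d → suc ∣ S ∣ ≤ k →
    (∀ v → agreementCount S v ≡ q ^ (k ∸ ∣ S ∣)) →
    ∀ v → agreementCount (S Vec.[ j ]≔ inside) v ≡ q ^ (k ∸ suc ∣ S ∣)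
  agreementCount-step dual-distance S j j∉S 1+∣S∣<d 1+∣S∣≤k uniform v
    with any? (λ m → T? (agreesOn S (encode G m) (zeroVec n) ∧ ⌊ lookup (encode G m) j ≟ 1# ⌋)) messages
  ... | yes witness =
    let m₀ , c₀≈0∧c₀ⱼ≡1 = Any.satisfied witness
        c₀≈0 , c₀ⱼ≡1 = Equivalence.to T-∧ c₀≈0∧c₀ⱼ≡1
    in *-cancelˡ-≡ _ _ q (begin
      q ℕ.* agreementCount (S Vec.[ j ]≔ inside) v  ≡⟨ agreementCount-insert S j m₀ j∉S c₀≈0 (toWitness c₀ⱼ≡1) v ⟩
      agreementCount S v                            ≡⟨ uniform v ⟩
      q ^ (k ∸ ∣ S ∣)                               ≡⟨ cong (q ^_) (+-∸-assoc 1 1+∣S∣≤k) ⟩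
      q ℕ.* q ^ (k ∸ suc ∣ S ∣)                     ∎)
    where
    open ≡.≡-Reasoning
    instance _ = ℕ.≢-nonZero q≢0
  ... | no no-witness =
    let coefficients , cⱼ≡ = noWitness⇒combination S j onto no-witness′
        u , u∈C⊥ , u≢0 , wt-u = combination⇒shortDualWord S j j∉S coefficients cⱼ≡
    in ⊥-elim (<-irrefl refl (≤-trans 1+∣S∣<d (≤-trans (dual-distance u u∈C⊥ u≢0) wt-u)))
    where
    instance _ = ℕ.≢-nonZero q≢0
    onto : ∀ v → ∃[ m ] T (agreesOn S (encode G m) v)
    onto v = let m , _ , agree = countWhere>0 _ messages (≡.subst (0 <_) (sym (uniform v)) (m^n>0 q (k ∸ ∣ S ∣))) in m , agree
    no-witness′ : ∀ m → T (agreesOn S (encode G m) (zeroVec n)) → lookup (encode G m) j ≢ 1#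
    no-witness′ m c≈0 cⱼ≡1 = no-witness (lose (∈-allVecs k m) (Equivalence.from T-∧ (c≈0 , fromWitness cⱼ≡1)))

  agreementCount-uniform : ∀ {d} → DualDistance≥ d →
    ∀ s (S : Subset n) → ∣ S ∣ ≡ s → s < d → s ≤ k → ∀ v → agreementCount S v ≡ q ^ (k ∸ s)
  agreementCount-uniform _ zero S ∣S∣≡0 _ _ v =
    ≡.trans (countWhere-all _ messages (λ m → agreesOn-empty S (encode G m) v ∣S∣≡0)) (length-allVecs k)
  agreementCount-uniform dual-distance (suc s) S ∣S∣≡1+s 1+s<d 1+s≤k v
    with j , j∈S , refl ← ∣S∣≡1+s⇒remove S s ∣S∣≡1+s =
    ≡.subst (λ S → agreementCount S v ≡ q ^ (k ∸ suc s)) restore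
      (agreementCount-step dual-distance S′ j (Vec.lookup∘updateAt j S) 1+s<d 1+s≤k
        (agreementCount-uniform dual-distance s S′ refl (≤-trans (n≤1+n _) 1+s<d) (≤-trans (n≤1+n s) 1+s≤k)) v)
    where
    S′ = S Vec.[ j ]≔ outside
    restore : S′ Vec.[ j ]≔ inside ≡ S
    restore = ≡.trans (Vec.[]≔-idempotent S j) (≡.trans (cong (S Vec.[ j ]≔_) (sym j∈S)) (Vec.[]≔-lookup S j))

  -- The number of pairs (c, T) with c ∈ C, T ⊆ M, |T| = t and c vanishing on S ∪ T.
  zeroMoment : Subset n → Subset n → ℕ → ℕ
  zeroMoment M S t = sum (List.map (λ m → if agreesOn S (encode G m) (zeroVec n) then zerosIn M (encode G m) C t else 0) messages)

  zeroMoment-pascal : ∀ (M S : Subset n) j t → lookup M j ≡ inside → lookup S j ≡ outside →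
    zeroMoment M S (suc t)
      ≡ zeroMoment (M Vec.[ j ]≔ outside) S (suc t) ℕ.+ zeroMoment (M Vec.[ j ]≔ outside) (S Vec.[ j ]≔ inside) t
  zeroMoment-pascal M S j t j∈M j∉S =
    ≡.trans (cong sum (List.map-cong pascal messages)) (sum-map-+ (moment S (suc t)) (moment (S Vec.[ j ]≔ inside) t) messages)
    where
    M′ = M Vec.[ j ]≔ outside
    moment : Subset n → ℕ → Vec F k → ℕ
    moment S′ t′ m = if agreesOn S′ (encode G m) (zeroVec n) then zerosIn M′ (encode G m) C t′ else 0
    pascal : ∀ m → (if agreesOn S (encode G m) (zeroVec n) then zerosIn M (encode G m) C suc t else 0)
                 ≡ moment S (suc t) m ℕ.+ moment (S Vec.[ j ]≔ inside) t m
    pascal m rewrite zerosIn-remove M j (encode G m) j∈M | agreesOn-insert S j (encode G m) (zeroVec n) j∉S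
                   | lookup-zeroVec {n} j
      with agreesOn S (encode G m) (zeroVec n) | ⌊ lookup (encode G m) j ≟ 0# ⌋
    ... | false | _     = refl
    ... | true  | false = ≡.trans (cong (_C suc t) (+-identityʳ-ℕ z′)) (sym (+-identityʳ-ℕ (z′ C suc t)))
      where z′ = zerosIn M′ (encode G m)
    ... | true  | true  = ≡.trans (cong (_C suc t) (+-comm-ℕ z′ 1))
                                   (≡.trans (sym (nCk+nC[k+1]≡[n+1]C[k+1] z′ t)) (+-comm-ℕ (z′ C t) (z′ C suc t)))
      where z′ = zerosIn M′ (encode G m)

  zeroMoment-formula : ∀ {d} → DualDistance≥ d →
    ∀ s (M S : Subset n) t → ∣ M ∣ ≡ s → (∀ i → lookup M i ≡ inside → lookup S i ≡ outside) →
    ∣ S ∣ ℕ.+ t < d → ∣ S ∣ ℕ.+ t ≤ k → zeroMoment M S t ≡ (s C t) ℕ.* q ^ (k ∸ ∣ S ∣ ∸ t)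
  zeroMoment-formula dual-distance s M S zero _ _ ∣S∣<d ∣S∣≤k = begin
    zeroMoment M S 0                ≡⟨ sum-map-indicator _ messages ⟩
    agreementCount S (zeroVec n)    ≡⟨ agreementCount-uniform dual-distance ∣ S ∣ S refl
                                         (≡.subst (_< _) (+-identityʳ-ℕ ∣ S ∣) ∣S∣<d)
                                         (≡.subst (_≤ k) (+-identityʳ-ℕ ∣ S ∣) ∣S∣≤k) (zeroVec n) ⟩
    q ^ (k ∸ ∣ S ∣)                 ≡⟨ +-identityʳ-ℕ (q ^ (k ∸ ∣ S ∣)) ⟨
    (s C 0) ℕ.* q ^ (k ∸ ∣ S ∣ ∸ 0) ∎
    where open ≡.≡-Reasoning
  zeroMoment-formula _ zero M S (suc t) ∣M∣≡0 _ _ _ = ≡.trans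
    (cong sum (List.map-cong (λ m → cong (λ z → if agreesOn S (encode G m) (zeroVec n) then z C suc t else 0)
                                         (zerosIn-empty M (encode G m) ∣M∣≡0)) messages))
    (≡.trans (cong sum (List.map-cong (λ m → if-same (agreesOn S (encode G m) (zeroVec n))) messages))
             (≡.trans (sum-map-const 0 messages) (*-zeroʳ (length messages))))
    where
    if-same : ∀ b → (if b then 0 else 0) ≡ 0
    if-same true  = refl
    if-same false = refl
  zeroMoment-formula {d} dual-distance (suc s) M S (suc t) ∣M∣≡1+s M∩S≡∅ ∣S∣+1+t<d ∣S∣+1+t≤k
    with j , j∈M , ∣M′∣≡s ← ∣S∣≡1+s⇒remove M s ∣M∣≡1+s = begin
    zeroMoment M S (suc t)
      ≡⟨ zeroMoment-pascal M S j t j∈M j∉S ⟩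
    zeroMoment M′ S (suc t) ℕ.+ zeroMoment M′ S⁺ t
      ≡⟨ cong₂ ℕ._+_ (zeroMoment-formula dual-distance s M′ S (suc t) ∣M′∣≡s M′∩S≡∅ ∣S∣+1+t<d ∣S∣+1+t≤k)
                     (zeroMoment-formula dual-distance s M′ S⁺ t ∣M′∣≡s M′∩S⁺≡∅
                        (≡.subst (_< d) (sym ∣S⁺∣+t≡∣S∣+1+t) ∣S∣+1+t<d)
                        (≡.subst (_≤ k) (sym ∣S⁺∣+t≡∣S∣+1+t) ∣S∣+1+t≤k)) ⟩
    (s C suc t) ℕ.* Q ℕ.+ (s C t) ℕ.* q ^ (k ∸ ∣ S⁺ ∣ ∸ t)
      ≡⟨ cong (λ e → (s C suc t) ℕ.* Q ℕ.+ (s C t) ℕ.* q ^ e) exponent ⟩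
    (s C suc t) ℕ.* Q ℕ.+ (s C t) ℕ.* Q
      ≡⟨ *-distribʳ-+ Q (s C suc t) (s C t) ⟨
    ((s C suc t) ℕ.+ (s C t)) ℕ.* Q
      ≡⟨ cong (ℕ._* Q) (≡.trans (+-comm-ℕ (s C suc t) (s C t)) (nCk+nC[k+1]≡[n+1]C[k+1] s t)) ⟩
    (suc s C suc t) ℕ.* Q ∎
    where
    open ≡.≡-Reasoning
    M′ = M Vec.[ j ]≔ outside
    S⁺ = S Vec.[ j ]≔ inside
    Q = q ^ (k ∸ ∣ S ∣ ∸ suc t)
    j∉S = M∩S≡∅ j j∈M
    M′∩S≡∅ : ∀ i → lookup M′ i ≡ inside → lookup S i ≡ outside
    M′∩S≡∅ i i∈M′ = M∩S≡∅ i (proj₂ (remove-⊆ M j i i∈M′))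
    M′∩S⁺≡∅ : ∀ i → lookup M′ i ≡ inside → lookup S⁺ i ≡ outside
    M′∩S⁺≡∅ i i∈M′ =
      ≡.trans (Vec.lookup∘updateAt′ i j (proj₁ (remove-⊆ M j i i∈M′)) S) (M′∩S≡∅ i i∈M′)
    ∣S⁺∣+t≡∣S∣+1+t : ∣ S⁺ ∣ ℕ.+ t ≡ ∣ S ∣ ℕ.+ suc t
    ∣S⁺∣+t≡∣S∣+1+t = ≡.trans (cong (ℕ._+ t) (∣insert∣ S j j∉S)) (sym (+-suc ∣ S ∣ t))
    exponent : k ∸ ∣ S⁺ ∣ ∸ t ≡ k ∸ ∣ S ∣ ∸ suc t
    exponent = begin
      k ∸ ∣ S⁺ ∣ ∸ t         ≡⟨ ∸-+-assoc k ∣ S⁺ ∣ t ⟩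
      k ∸ (∣ S⁺ ∣ ℕ.+ t)     ≡⟨ cong (k ∸_) ∣S⁺∣+t≡∣S∣+1+t ⟩
      k ∸ (∣ S ∣ ℕ.+ suc t)  ≡⟨ ∸-+-assoc k ∣ S ∣ (suc t) ⟨
      k ∸ ∣ S ∣ ∸ suc t      ∎

  binomialMoment-messages : ∀ {d} → DualDistance≥ d → ∀ t → t < d → t ≤ k →
    sum (List.map (λ m → (n ∸ wt (encode G m)) C t) messages) ≡ (n C t) ℕ.* q ^ (k ∸ t)
  binomialMoment-messages dual-distance t t<d t≤k = begin
    sum (List.map (λ m → (n ∸ wt (encode G m)) C t) messages)
      ≡⟨ cong sum (List.map-cong unconstrained messages) ⟩
    zeroMoment Subset.⊤ Subset.⊥ t
      ≡⟨ zeroMoment-formula dual-distance n Subset.⊤ Subset.⊥ t (∣⊤∣≡n n) (λ i _ → Vec.lookup-replicate i outside)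
           (≡.subst (λ s → s ℕ.+ t < _) (sym (∣⊥∣≡0 n)) t<d)
           (≡.subst (λ s → s ℕ.+ t ≤ k) (sym (∣⊥∣≡0 n)) t≤k) ⟩
    (n C t) ℕ.* q ^ (k ∸ ∣ Subset.⊥ {n} ∣ ∸ t)
      ≡⟨ cong (λ s → (n C t) ℕ.* q ^ (k ∸ s ∸ t)) (∣⊥∣≡0 n) ⟩
    (n C t) ℕ.* q ^ (k ∸ t) ∎
    where
    open ≡.≡-Reasoning
    unconstrained : ∀ m → (n ∸ wt (encode G m)) C t
                     ≡ (if agreesOn Subset.⊥ (encode G m) (zeroVec n) then zerosIn Subset.⊤ (encode G m) C t else 0)
    unconstrained m rewrite Equivalence.to T-≡ (agreesOn-empty Subset.⊥ (encode G m) (zeroVec n) (∣⊥∣≡0 n)) =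
      cong (_C t) (≡.trans (cong (ℕ._∸ wt (encode G m)) (sym (zerosIn-⊤+wt (encode G m))))
                           (m+n∸n≡m (zerosIn Subset.⊤ (encode G m)) (wt (encode G m))))

  weightCount : ℕ → ℕ
  weightCount w = countWhere (λ m → wt (encode G m) ≡ᵇ w) messages

  A≡weightCount : FullRank G → ∀ w → A G w ≡ weightCount w
  A≡weightCount full-rank w = ≡.trans
    (sym (countWhere-restrict (isCodeword G) (λ x → wt x ≡ᵇ w) (allVecs-unique n)
           (Unique.map⁺ (full-rank _ _) (allVecs-unique k)) (mk⇔ to from)))
    (countWhere-map (λ x → wt x ≡ᵇ w) (encode G) messages)
    where
    encodes? : Vec F n → Vec F k → Bool
    encodes? x m = does (Vec.≡-dec _≟_ (encode G m) x)
    to : ∀ {x} → x ∈ List.map (encode G) messages → x ∈ allVecs n × T (isCodeword G x)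
    to x∈C with ∈-map⁻ (encode G) x∈C
    ... | m , _ , refl = ∈-allVecs n _ , any⁺ (encodes? (encode G m))
      (lose (∈-allVecs k m) (Equivalence.from (T-does (Vec.≡-dec _≟_ (encode G m) (encode G m))) (refl {x = encode G m})))
    from : ∀ {x} → x ∈ allVecs n × T (isCodeword G x) → x ∈ List.map (encode G) messages
    from {x} (_ , codeword) with Any.satisfied (any⁻ (encodes? x) messages codeword)
    ... | m , encodes =
      ≡.subst (_∈ _) (Equivalence.to (T-does (Vec.≡-dec _≟_ (encode G m) x)) encodes) (∈-map⁺ (encode G) (∈-allVecs k m))

  weightCount-zero : FullRank G → weightCount 0 ≡ 1
  weightCount-zero full-rank = countWhere≡1 _ (allVecs-unique k) (∈-allVecs k (zeroVec k))
    (≡⇒≡ᵇ _ 0 (≡.trans (cong wt (encode-zero G)) (wt-zeroVec n)))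
    (λ {m} wt≡0 → full-rank m (zeroVec k)
       (≡.trans (wt≡0⇒≡zeroVec (encode G m) (≡ᵇ⇒≡ _ 0 wt≡0)) (sym (encode-zero G))))

  weightCount-below-distance : ∀ {d} → Distance≥ d →
    ∀ w → 0 < w → w < d → weightCount w ≡ 0
  weightCount-below-distance distance w 0<w w<d = countWhere-none _ messages λ m wt≡ᵇw →
    let wt≡w = ≡ᵇ⇒≡ _ w wt≡ᵇw in
    <-irrefl refl (≤-trans w<d (≤-trans (distance (encode G m) (m , refl) λ c≡0 →
      <-irrefl (≡.trans (sym (wt-zeroVec n)) (≡.trans (cong wt (sym c≡0)) wt≡w)) 0<w) (≤-reflexive wt≡w)))

  A-zero : FullRank G → A G 0 ≡ 1
  A-zero full-rank = ≡.trans (A≡weightCount full-rank 0) (weightCount-zero full-rank)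

  A-below-distance : FullRank G → ∀ {d} → Distance≥ d → ∀ w → 0 < w → w < d → A G w ≡ 0
  A-below-distance full-rank distance w 0<w w<d =
    ≡.trans (A≡weightCount full-rank w) (weightCount-below-distance distance w 0<w w<d)

  A-binomialMoment : FullRank G → ∀ {d} → DualDistance≥ d → ∀ t → t < d → t ≤ k →
    sumBelow (suc n) (λ w → + (((n ∸ w) C t) ℕ.* A G w)) ≡ + ((n C t) ℕ.* q ^ (k ∸ t))
  A-binomialMoment full-rank dual-distance t t<d t≤k = begin
    sumBelow (suc n) (λ w → + (((n ∸ w) C t) ℕ.* A G w))
      ≡⟨ sumBelow-cong (suc n) _ _ (λ w _ → cong (λ c → + (((n ∸ w) C t) ℕ.* c)) (A≡weightCount full-rank w)) ⟩
    sumBelow (suc n) (λ w → + (((n ∸ w) C t) ℕ.* weightCount w))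
      ≡⟨ sum-map-by-value (λ w → (n ∸ w) C t) (λ m → wt (encode G m)) n messages (λ m → wt≤length (encode G m)) ⟨
    + sum (List.map (λ m → (n ∸ wt (encode G m)) C t) messages)
      ≡⟨ cong +_ (binomialMoment-messages dual-distance t t<d t≤k) ⟩
    + ((n C t) ℕ.* q ^ (k ∸ t)) ∎
    where open ≡.≡-Reasoning

-- Length n = d + k and dimension k = s₁ + K, where σ = 1 + s₁ and K = k + 1 − σ; this
-- parametrisation avoids truncated subtraction.
module MomentInversion (q : ℕ) (a : ℕ → ℕ) (d s₁ K : ℕ) (1≤d : 1 ≤ d) (a₀≡1 : a 0 ≡ 1)
  (gap : ∀ w → 0 < w → w < d → a w ≡ 0)
  (moments : ∀ t → t ≤ K → sumBelow (suc (d ℕ.+ (s₁ ℕ.+ K))) (λ w → + (((d ℕ.+ (s₁ ℕ.+ K) ∸ w) C t) ℕ.* a w))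
                              ≡ + (((d ℕ.+ (s₁ ℕ.+ K)) C t) ℕ.* q ^ (s₁ ℕ.+ K ∸ t))) where
  open import Data.Integer using (_+_; _*_; _-_)
  open ≡.≡-Reasoning

  k n : ℕ
  k = s₁ ℕ.+ K
  n = d ℕ.+ k

  y : ℕ → ℤ
  y l = + a (d ℕ.+ s₁ ℕ.+ l)

  R : ℕ → ℤ
  R j = + (n C (K ∸ j)) * (+ q ^ (k ∸ (K ∸ j)) - + 1) - sumBelow s₁ (λ h → + ((k ∸ h) C (K ∸ j)) * + a (d ℕ.+ h))

  moment-split : ∀ t → t ≤ K →
    + (n C t) + sumBelow (suc k) (λ p → + ((k ∸ p) C t) * + a (d ℕ.+ p)) ≡ + (n C t) * + q ^ (k ∸ t)
  moment-split t t≤K = begin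
    + (n C t) + sumBelow (suc k) (λ p → + ((k ∸ p) C t) * + a (d ℕ.+ p))
      ≡⟨ cong₂ _+_ (sym low-weights) (sumBelow-cong (suc k) _ _ λ p _ →
           ≡.trans (sym (ℤP.pos-* ((k ∸ p) C t) (a (d ℕ.+ p))))
                   (cong (λ m → + ((m C t) ℕ.* a (d ℕ.+ p))) (sym ([m+n]∸[m+o]≡n∸o d k p)))) ⟩
    sumBelow d term + sumBelow (suc k) (λ p → term (d ℕ.+ p))
      ≡⟨ sumBelow-++ d (suc k) term ⟨
    sumBelow (d ℕ.+ suc k) term
      ≡⟨ cong (λ m → sumBelow m term) (+-suc d k) ⟩
    sumBelow (suc n) term
      ≡⟨ moments t t≤K ⟩
    + ((n C t) ℕ.* q ^ (k ∸ t))
      ≡⟨ ℤP.pos-* (n C t) _ ⟩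
    + (n C t) * + q ^ (k ∸ t) ∎
    where
    term : ℕ → ℤ
    term w = + (((n ∸ w) C t) ℕ.* a w)
    low-weights : sumBelow d term ≡ + (n C t)
    low-weights = begin
      sumBelow d term
        ≡⟨ cong (λ m → sumBelow m term) (m+[n∸m]≡n 1≤d) ⟨
      sumBelow (1 ℕ.+ (d ∸ 1)) term
        ≡⟨ sumBelow-++ 1 (d ∸ 1) term ⟩
      (+ 0 + term 0) + sumBelow (d ∸ 1) (λ w → term (suc w))
        ≡⟨ cong₂ _+_ (cong (λ c → + 0 + + ((n C t) ℕ.* c)) a₀≡1)
                     (sumBelow-zero (d ∸ 1) _ (λ w w<d-1 →
                        ≡.trans (cong (λ c → + (((n ∸ suc w) C t) ℕ.* c))
                                      (gap (suc w) (s≤s z≤n) (≤-trans (s≤s w<d-1) (≤-reflexive (m+[n∸m]≡n 1≤d)))))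
                                (cong +_ (*-zeroʳ ((n ∸ suc w) C t))))) ⟩
      (+ 0 + + ((n C t) ℕ.* 1)) + + 0
        ≡⟨ ℤP.+-identityʳ _ ⟩
      + 0 + + ((n C t) ℕ.* 1)
        ≡⟨ ℤP.+-identityˡ _ ⟩
      + ((n C t) ℕ.* 1)
        ≡⟨ cong +_ (*-identityʳ-ℕ (n C t)) ⟩
      + (n C t) ∎

  triangular : ∀ j → j ≤ K → R j ≡ sumBelow (suc j) (λ l → + ((K ∸ l) C (K ∸ j)) * y l)
  triangular j j≤K = begin
    A * (Q - + 1) - H                              ≡⟨ distribute A Q H ⟨
    A * Q - A - H                                  ≡⟨ cong (λ z → z - A - H) (moment-split t (m∸n≤m K j)) ⟨
    A + sumBelow (suc k) X - A - H                 ≡⟨ cong (λ z → A + z - A - H) split ⟩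
    A + (H + Y) - A - H                            ≡⟨ cancel A H Y ⟩
    Y                                              ∎
    where
    t = K ∸ j
    A = + (n C t)
    Q = + q ^ (k ∸ t)
    X : ℕ → ℤ
    X p = + ((k ∸ p) C t) * + a (d ℕ.+ p)
    H = sumBelow s₁ X
    Yₗ : ℕ → ℤ
    Yₗ l = + ((K ∸ l) C t) * y l
    Y = sumBelow (suc j) Yₗ
    distribute : ∀ A Q H → A * Q - A - H ≡ A * (Q - + 1) - H
    distribute = solve-∀ℤ
    cancel : ∀ A H Y → A + (H + Y) - A - H ≡ Y
    cancel = solve-∀ℤ
    beyond-j : ∀ x → x < K ∸ j → Yₗ (suc j ℕ.+ x) ≡ + 0
    beyond-j x x<K∸j = ≡.trans (cong (λ c → + c * y (suc j ℕ.+ x)) (k>n⇒nCk≡0 (∸-monoʳ-< (s≤s (m≤m+n j x)) in-range)))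
                               (ℤP.*-zeroˡ (y (suc j ℕ.+ x)))
      where
      in-range : suc j ℕ.+ x ≤ K
      in-range = ≤-trans (≤-reflexive (sym (+-suc j x))) (≤-trans (+-monoʳ-≤ j x<K∸j) (≤-reflexive (m+[n∸m]≡n j≤K)))
    split : sumBelow (suc k) X ≡ H + Y
    split = begin
      sumBelow (suc k) X
        ≡⟨ cong (λ m → sumBelow m X) (+-suc s₁ K) ⟨
      sumBelow (s₁ ℕ.+ suc K) X
        ≡⟨ sumBelow-++ s₁ (suc K) X ⟩
      H + sumBelow (suc K) (λ l → X (s₁ ℕ.+ l))
        ≡⟨ cong (_+_ H) (sumBelow-cong (suc K) _ _ λ l _ →
             cong₂ (λ u v → + (u C t) * + a v) ([m+n]∸[m+o]≡n∸o s₁ K l) (sym (+-assoc-ℕ d s₁ l))) ⟩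
      H + sumBelow (suc K) Yₗ
        ≡⟨ cong (λ m → H + sumBelow (suc m) Yₗ) (m+[n∸m]≡n j≤K) ⟨
      H + sumBelow (suc j ℕ.+ (K ∸ j)) Yₗ
        ≡⟨ cong (_+_ H) (sumBelow-++ (suc j) (K ∸ j) Yₗ) ⟩
      H + (Y + sumBelow (K ∸ j) (λ x → Yₗ (suc j ℕ.+ x)))
        ≡⟨ cong (λ z → H + (Y + z)) (sumBelow-zero (K ∸ j) _ beyond-j) ⟩
      H + (Y + + 0)
        ≡⟨ cong (_+_ H) (ℤP.+-identityʳ Y) ⟩
      H + Y ∎

  inverted : ∀ i → i ≤ K → y i ≡ sumBelow (suc i) (λ j → sign (i ∸ j) * + ((K ∸ j) C (i ∸ j)) * R j)
  inverted = binomial-inversion K y R triangular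

  R-closed-form : ∀ j → j ≤ K →
    R j ≡ + (n C (d ℕ.+ s₁ ℕ.+ j)) * (+ q ^ (j ℕ.+ s₁) - + 1)
          - sumBelow s₁ (λ h → + ((k ∸ h) C (s₁ ℕ.+ j ∸ h)) * + a (d ℕ.+ h))
  R-closed-form j j≤K = cong₂ _-_
    (cong₂ _*_ (cong +_ (sym complement-weight)) (cong (λ m → + q ^ m - + 1) exponent))
    (sumBelow-cong s₁ _ _ (λ h h<s₁ → cong (λ c → + c * + a (d ℕ.+ h)) (complement-shortened h (<⇒≤ h<s₁))))
    where
    exponent : k ∸ (K ∸ j) ≡ j ℕ.+ s₁
    exponent = ≡.trans (+-∸-assoc s₁ (m∸n≤m K j)) (≡.trans (cong (s₁ ℕ.+_) (m∸[m∸n]≡n j≤K)) (+-comm-ℕ s₁ j))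
    complement-weight : n C (d ℕ.+ s₁ ℕ.+ j) ≡ n C (K ∸ j)
    complement-weight = begin
      n C (d ℕ.+ s₁ ℕ.+ j)
        ≡⟨ nCk≡nC[n∸k] (≤-trans (≤-reflexive (+-assoc-ℕ d s₁ j)) (+-monoʳ-≤ d (+-monoʳ-≤ s₁ j≤K))) ⟩
      n C (n ∸ (d ℕ.+ s₁ ℕ.+ j))
        ≡⟨ cong (n C_) (≡.trans (cong (n ∸_) (+-assoc-ℕ d s₁ j))
                                (≡.trans ([m+n]∸[m+o]≡n∸o d k (s₁ ℕ.+ j)) ([m+n]∸[m+o]≡n∸o s₁ K j))) ⟩
      n C (K ∸ j) ∎
    complement-shortened : ∀ h → h ≤ s₁ → (k ∸ h) C (K ∸ j) ≡ (k ∸ h) C (s₁ ℕ.+ j ∸ h)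
    complement-shortened h h≤s₁ = sym (begin
      (k ∸ h) C (s₁ ℕ.+ j ∸ h)                 ≡⟨ nCk≡nC[n∸k] (∸-monoˡ-≤ h (+-monoʳ-≤ s₁ j≤K)) ⟩
      (k ∸ h) C (k ∸ h ∸ (s₁ ℕ.+ j ∸ h))       ≡⟨ cong ((k ∸ h) C_) (begin
          s₁ ℕ.+ K ∸ h ∸ (s₁ ℕ.+ j ∸ h)         ≡⟨ cong₂ _∸_ (+-∸-comm K h≤s₁) (+-∸-comm j h≤s₁) ⟩
          s₁ ∸ h ℕ.+ K ∸ (s₁ ∸ h ℕ.+ j)         ≡⟨ [m+n]∸[m+o]≡n∸o (s₁ ∸ h) K j ⟩
          K ∸ j                                 ∎) ⟩
      (k ∸ h) C (K ∸ j)                        ∎)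

BinomialMoments : ℕ → (ℕ → ℕ) → ℕ → ℕ → ℕ → Set
BinomialMoments q a n k σ = ∀ t → t ℕ.+ σ ≤ k ℕ.+ 1 →
  sumBelow (suc n) (λ w → + (((n ∸ w) C t) ℕ.* a w)) ≡ + ((n C t) ℕ.* q ^ (k ∸ t))

WeightFormula : ℕ → (ℕ → ℕ) → ℕ → ℕ → ℕ → Set
WeightFormula q a n k σ = ∀ i → i ℕ.+ σ ≤ k ℕ.+ 1 →
  + a (n ∸ k ℕ.+ (σ ∸ 1) ℕ.+ i)
  ≡ sumBelow (ℕ.suc i) (λ j →
      (-[1+ 0 ] ℤ.^ (i ∸ j))
      ℤ.* + ((k ℕ.+ 1 ∸ σ ∸ j) C (i ∸ j))
      ℤ.* ( + (n C (n ∸ k ℕ.+ (σ ∸ 1) ℕ.+ j)) ℤ.* (+ (q ℕ.^ (j ℕ.+ (σ ∸ 1))) ℤ.- + 1)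
            ℤ.- sumBelow (σ ∸ 1) (λ h →
                  + ((k ∸ h) C (σ ∸ 1 ℕ.+ j ∸ h)) ℤ.* + a (n ∸ k ℕ.+ h))))

weight-formula-decomposed : ∀ q (a : ℕ → ℕ) d s₁ K {n k σ} →
  n ≡ d ℕ.+ k → k ≡ s₁ ℕ.+ K → σ ≡ suc s₁ → 1 ≤ d →
  a 0 ≡ 1 → (∀ w → 0 < w → w < n ∸ k → a w ≡ 0) → BinomialMoments q a n k σ → WeightFormula q a n k σ
weight-formula-decomposed q a d s₁ K refl refl refl 1≤d a₀≡1 gap moments i i+σ≤k+1 = begin
  + a (n ∸ k ℕ.+ s₁ ℕ.+ i)
    ≡⟨ cong (λ d′ → + a (d′ ℕ.+ s₁ ℕ.+ i)) n∸k≡d ⟩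
  y i
    ≡⟨ inverted i (≤-K i i+σ≤k+1) ⟩
  sumBelow (suc i) (λ j → sign (i ∸ j) ℤ.* + ((K ∸ j) C (i ∸ j)) ℤ.* R j)
    ≡⟨ sumBelow-cong (suc i) _ _ (λ j j<1+i → cong₂ ℤ._*_
         (cong (λ m → sign (i ∸ j) ℤ.* + ((m ∸ j) C (i ∸ j))) (sym k+1∸σ≡K))
         (≡.trans (R-closed-form j (≤-trans (≤-pred j<1+i) (≤-K i i+σ≤k+1)))
                  (cong (λ d′ → + (n C (d′ ℕ.+ s₁ ℕ.+ j)) ℤ.* (+ q ^ (j ℕ.+ s₁) ℤ.- + 1)
                                 ℤ.- sumBelow s₁ (λ h → + ((k ∸ h) C (s₁ ℕ.+ j ∸ h)) ℤ.* + a (d′ ℕ.+ h)))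
                        (sym n∸k≡d)))) ⟩
  _ ∎
  where
  open ≡.≡-Reasoning
  k = s₁ ℕ.+ K
  n = d ℕ.+ k
  n∸k≡d : n ∸ k ≡ d
  n∸k≡d = m+n∸n≡m d k
  k+1∸σ≡K : k ℕ.+ 1 ∸ suc s₁ ≡ K
  k+1∸σ≡K = ≡.trans (cong (_∸ suc s₁) (+-comm-ℕ k 1)) (m+n∸m≡n s₁ K)
  K+σ≡k+1 : K ℕ.+ suc s₁ ≡ k ℕ.+ 1
  K+σ≡k+1 = ≡.trans (+-suc K s₁) (≡.trans (cong suc (+-comm-ℕ K s₁)) (+-comm-ℕ 1 k))
  ≤-K : ∀ t → t ℕ.+ suc s₁ ≤ k ℕ.+ 1 → t ≤ K
  ≤-K t t+σ≤k+1 = +-cancelʳ-≤ (suc s₁) t K (≤-trans t+σ≤k+1 (≤-reflexive (sym K+σ≡k+1)))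
  open MomentInversion q a d s₁ K 1≤d a₀≡1
         (λ w 0<w w<d → gap w 0<w (≡.subst (w <_) (sym n∸k≡d) w<d))
         (λ t t≤K → moments t (≤-trans (+-monoˡ-≤ (suc s₁) t≤K) (≤-reflexive K+σ≡k+1)))
    using (y; R; inverted; R-closed-form)

weight-formula : ∀ q (a : ℕ → ℕ) n k σ → 2 ≤ σ → k < n → a 0 ≡ 1 →
  (∀ w → 0 < w → w < n ∸ k → a w ≡ 0) → BinomialMoments q a n k σ → WeightFormula q a n k σ
weight-formula q a n k σ 2≤σ k<n a₀≡1 gap moments i i+σ≤k+1 =
  weight-formula-decomposed q a (n ∸ k) (σ ∸ 1) (k ∸ (σ ∸ 1))
    (sym (m∸n+n≡m (<⇒≤ k<n))) (sym (m+[n∸m]≡n σ∸1≤k)) (sym (m+[n∸m]≡n (≤-trans (s≤s z≤n) 2≤σ)))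
    (m<n⇒0<n∸m k<n) a₀≡1 gap moments i i+σ≤k+1
  where
  σ∸1≤k : σ ∸ 1 ≤ k
  σ∸1≤k = ≤-trans (∸-monoˡ-≤ 1 (≤-trans (m≤n+m σ i) i+σ≤k+1)) (≤-reflexive (m+n∸n≡m k 1))


proposition4p3 : ∀ {q : ℕ} (𝔽 : FiniteField q) → IsPrimePower q →
  ∀ (σ : ℕ) → 2 ≤ σ →
  ∀ (n k : ℕ) (G : Vec (Vec (FiniteField.F 𝔽) n) k) →
  Code.FullRank 𝔽 G →
  Code.MinDistance 𝔽 (Code.InCode 𝔽 G) (n ∸ k) →
  ∀ (d⊥ : ℕ) → d⊥ ℕ.+ σ ≡ k ℕ.+ 2 →
  Code.MinDistance 𝔽 (Code.InDual 𝔽 G) d⊥ →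
  (Code.A 𝔽 G 0 ≡ 1)
  × (∀ s → 1 ≤ s → s ℕ.+ 1 ≤ n ∸ k → Code.A 𝔽 G s ≡ 0)
  × (∀ i → i ℕ.+ σ ≤ k ℕ.+ 1 →
      + Code.A 𝔽 G (n ∸ k ℕ.+ (σ ∸ 1) ℕ.+ i)
      ≡ sumBelow (ℕ.suc i) (λ j →
          (-[1+ 0 ] ℤ.^ (i ∸ j))
          ℤ.* + ((k ℕ.+ 1 ∸ σ ∸ j) C (i ∸ j))
          ℤ.* ( + (n C (n ∸ k ℕ.+ (σ ∸ 1) ℕ.+ j)) ℤ.* (+ (q ℕ.^ (j ℕ.+ (σ ∸ 1))) ℤ.- + 1)
                ℤ.- sumBelow (σ ∸ 1) (λ h →
                      + ((k ∸ h) C (σ ∸ 1 ℕ.+ j ∸ h)) ℤ.* + Code.A 𝔽 G (n ∸ k ℕ.+ h)))))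
proposition4p3 {q} 𝔽 _ σ 2≤σ n k G full-rank (distance , (x , _ , x≢0 , wt≡n∸k)) d⊥ d⊥+σ≡k+2 (dual-distance , _) =
  A-zero full-rank ,
  (λ s 1≤s s+1≤n∸k → gap s 1≤s (≤-trans (≤-reflexive (+-comm-ℕ 1 s)) s+1≤n∸k)) ,
  weight-formula q (A G) n k σ 2≤σ k<n (A-zero full-rank) gap moments
  where
  open Code 𝔽
  open VectorSpace 𝔽
  open LinearCode 𝔽 G
  gap : ∀ w → 0 < w → w < n ∸ k → A G w ≡ 0
  gap = A-below-distance full-rank distance
  k<n : k < n
  k<n = ≰⇒> λ n≤k → x≢0 (wt≡0⇒≡zeroVec x (≡.trans wt≡n∸k (m≤n⇒m∸n≡0 n≤k)))
  moments : BinomialMoments q (A G) n k σ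
  moments t t+σ≤k+1 = A-binomialMoment full-rank dual-distance t
    (+-cancelʳ-< σ t d⊥ (≤-trans (s≤s t+σ≤k+1) (≤-reflexive (≡.trans (sym (+-suc k 1)) (sym d⊥+σ≡k+2)))))
    (+-cancelʳ-≤ 1 t k (≤-trans (+-monoʳ-≤ t (≤-trans (s≤s z≤n) 2≤σ)) t+σ≤k+1))
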